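{- Let $n_1,n_2\ge 3$ be integers with $n_1\mid n_2$. Then the critical group $K(C_4\times C_{n_1})$ is (isomorphic to) a subgroup of the critical group $K(C_4\times C_{n_2})$.
   Context: For a finite connected graph $G=(V,E)$, the Laplacian $L(G)$ is the $|V|\times|V|$ integer matrix with $L_{uu}=\deg(u)$ and $L_{uv}=-(\text{number of edges joining }u,v)$ for $u\ne v$. If the Smith normal form of $L(G)$ is $\mathrm{diag}(t_1,\dots,t_{|V|-1},0)$, the critical group is $K(G)=\bigoplus_{i=1}^{|V|-1}\mathbb{Z}/t_i\mathbb{Z}$. $C_n$ denotes the cycle on $n$ vertices and $C_4\times C_n$ the Cartesian product graph (vertices $(u,v)$, with $(u_1,v_1)\sim(u_2,v_2)$ iff $u_1=u_2$ and $v_1\sim v_2$, or $u_1\sim u_2$ and $v_1=v_2$). -}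

module Defs where

open import Data.Nat as ℕ using (ℕ; zero; suc; pred)
open import Data.Fin as Fin using (Fin; toℕ; fromℕ<; remQuot)
open import Data.Bool using (Bool; true; false; if_then_else_; _∨_; _∧_)
open import Data.Integer as ℤ using (ℤ; +_; _-_)
open import Data.Integer.Divisibility using () renaming (_∣_ to _∣ℤ_)
open import Data.Nat.Divisibility using (_∣_)
open import Data.Product using (Σ; _×_; _,_)
open import Relation.Nullary using (does; yes; no)
open import Relation.Binary.PropositionalEquality using (_≡_)

sumFin : ∀ {N} → (Fin N → ℤ) → ℤ
sumFin {zero}  f = + 0
sumFin {suc N} f = f Fin.zero ℤ.+ sumFin (λ i → f (Fin.suc i))

Mat : ℕ → Set
Mat N = Fin N → Fin N → ℤ

_⊗_ : ∀ {N} → Mat N → Mat N → Mat N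
(A ⊗ B) i k = sumFin (λ j → A i j ℤ.* B j k)

idMat : ∀ {N} → Mat N
idMat i j = if does (i Fin.≟ j) then + 1 else + 0

Unimodular : ∀ {N} → Mat N → Set
Unimodular {N} P = Σ (Mat N) λ P' → (∀ i j → (P ⊗ P') i j ≡ idMat i j)
                                   × (∀ i j → (P' ⊗ P) i j ≡ idMat i j)

-- Graphs given by their edge-multiplicity function A u v
-- (number of edges joining u and v); Laplacian

Graph : ℕ → Set
Graph N = Fin N → Fin N → ℕ

deg : ∀ {N} → Graph N → Fin N → ℤ
deg A u = sumFin (λ v → + A u v)

Laplacian : ∀ {N} → Graph N → Mat N
Laplacian A u v = if does (u Fin.≟ v) then deg A u else ℤ.- (+ A u v)

-- the cycle C_n on vertices 0,…,n-1, edges {i, i+1 mod n} (used for n ≥ 3)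
cycleAdj : ∀ n → (Fin n → Fin n → Bool)
cycleAdj n u v =
     does (toℕ v ℕ.≟ suc (toℕ u))
  ∨ does (toℕ u ℕ.≟ suc (toℕ v))
  ∨ (does (suc (toℕ u) ℕ.≟ n) ∧ does (toℕ v ℕ.≟ 0))
  ∨ (does (suc (toℕ v) ℕ.≟ n) ∧ does (toℕ u ℕ.≟ 0))

Cycle : ∀ n → Graph n
Cycle n u v = if cycleAdj n u v then 1 else 0

-- Cartesian product on vertex set Fin m × Fin n ≅ Fin (m * n) (via remQuot)
_□_ : ∀ {m n} → Graph m → Graph n → Graph (m ℕ.* n)
(_□_ {m} {n} A B) x y with remQuot {m} n x | remQuot {m} n y
... | (u₁ , v₁) | (u₂ , v₂) =
  (if does (u₁ Fin.≟ u₂) then B v₁ v₂ else 0)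
  ℕ.+ (if does (v₁ Fin.≟ v₂) then A u₁ u₂ else 0)

C4×C : ∀ n → Graph (4 ℕ.* n)
C4×C n = Cycle 4 □ Cycle n

snfDiag : ∀ {N} → (Fin (pred N) → ℕ) → Mat N
snfDiag {N} t i j with i Fin.≟ j | toℕ i ℕ.<? pred N
... | yes _ | yes p = + t (fromℕ< p)
... | yes _ | no _  = + 0
... | no _  | _     = + 0

IsSNF : ∀ {N} → Mat N → (Fin (pred N) → ℕ) → Set
IsSNF {N} L t =
    (∀ i j → i Fin.≤ j → t i ∣ t j)
  × Σ (Mat N) λ P → Σ (Mat N) λ Q →
      Unimodular P × Unimodular Q × (∀ i j → ((P ⊗ L) ⊗ Q) i j ≡ snfDiag t i j)

-- The group ⊕_{i<m} ℤ/t_i ℤ : carrier Fin m → ℤ modulo componentwise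
-- congruence; and "isomorphic to a subgroup" = injective homomorphism

_≈[_]_ : ∀ {m} → (Fin m → ℤ) → (Fin m → ℕ) → (Fin m → ℤ) → Set
x ≈[ t ] y = ∀ i → (+ t i) ∣ℤ (x i - y i)

EmbedsInto : ∀ {m k} → (Fin m → ℕ) → (Fin k → ℕ) → Set
EmbedsInto {m} {k} t s =
  Σ ((Fin m → ℤ) → (Fin k → ℤ)) λ φ →
      (∀ x y → x ≈[ t ] y → φ x ≈[ s ] φ y)
    × (∀ x y → φ (λ i → x i ℤ.+ y i) ≈[ s ] (λ j → φ x j ℤ.+ φ y j))
    × (∀ x y → φ x ≈[ s ] φ y → x ≈[ t ] y)

module Submission where

-- Reducing the second coordinate modulo n₁ is a covering π of C₄ × C_{n₁} by
-- C₄ × C_{n₂}.  Pulling vertex functions back along π commutes with the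
-- Laplacians, so it induces a homomorphism coker L₁ → coker L₂.  It is injective
-- by descent: if L₂ z is a pull-back then so is z, because the difference
-- z(a, b + n₁) - z(a, b) is harmonic, hence constant by the maximum principle,
-- and the constant vanishes since n₂/n₁ such translations close up.  In Smith
-- coordinates coker Lᵢ ≅ ⊕ ℤ/tᵢ ⊕ ℤ and torsion maps to torsion, which yields
-- the embedding ⊕ ℤ/t₁ → ⊕ ℤ/t₂.

open import Defs
open import Data.Nat using (ℕ; _≤_; _*_; pred)
open import Data.Nat.Divisibility using (_∣_)
open import Data.Fin using (Fin)
open import Data.Nat as N using (zero; suc; NonZero; _%_; s≤s; z≤n)
import Data.Nat.Properties as NP
import Data.Nat.DivMod as ND
import Data.Nat.Divisibility as NDv
import Data.Nat.Tactic.RingSolver as ℕ-Solver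
import Data.Fin as F
open F using (toℕ; fromℕ<)
import Data.Fin.Properties as FP
open import Data.Integer as Z using (ℤ; +_; +≤+)
  renaming (_+_ to _+ᶻ_; _*_ to _*ᶻ_; _-_ to _-ᶻ_; -_ to -ᶻ_)
import Data.Integer.Properties as ZP
import Data.Integer.Divisibility.Signed as ZS
open import Data.Integer.Tactic.RingSolver using (solve-∀)
open import Data.Bool using (true; false; if_then_else_)
open import Data.Product using (Σ; _×_; _,_; proj₁; proj₂)
open import Data.Sum using (_⊎_; inj₁; inj₂)
open import Data.Empty using (⊥; ⊥-elim)
open import Function using (_∘_)
open import Function.Bundles using (_⇔_; mk⇔; Equivalence)
open import Relation.Binary.PropositionalEquality
open import Relation.Nullary using (Dec; does; yes; no; ¬_)
open import Relation.Nullary.Decidable using (_⊎-dec_; _×-dec_; does-⇔; dec-false)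

ℤ^_ : ℕ → Set
ℤ^ N = Fin N → ℤ

infixr 6 _·_
_·_ : ∀ {N} → Mat N → ℤ^ N → ℤ^ N
(A · v) i = sumFin (λ j → A i j *ᶻ v j)

record _∈Im_ {N} (v : ℤ^ N) (A : Mat N) : Set where
  constructor image
  field
    preimage : ℤ^ N
    equation : ∀ i → v i ≡ (A · preimage) i

∈Im-cong : ∀ {N} {A : Mat N} {u v : ℤ^ N} → (∀ i → u i ≡ v i) → u ∈Im A → v ∈Im A
∈Im-cong u≡v (image w u≡Aw) = image w λ i → trans (sym (u≡v i)) (u≡Aw i)

-- Every vector in the kernel of A is constant (for a Laplacian: connectedness).
ConstantKernel : ∀ {N} → Mat N → Set
ConstantKernel {N} A = ∀ (f : ℤ^ N) → (∀ x → (A · f) x ≡ + 0) → ∀ x y → f x ≡ f y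

sum-cong : ∀ {N} {f g : ℤ^ N} → (∀ i → f i ≡ g i) → sumFin f ≡ sumFin g
sum-cong {zero}  e = refl
sum-cong {suc N} e = cong₂ _+ᶻ_ (e F.zero) (sum-cong (e ∘ F.suc))

sum-zero : ∀ {N} → sumFin {N} (λ _ → + 0) ≡ + 0
sum-zero {zero}  = refl
sum-zero {suc N} = trans (ZP.+-identityˡ _) (sum-zero {N})

sum-+ : ∀ {N} (f g : ℤ^ N) → sumFin (λ i → f i +ᶻ g i) ≡ sumFin f +ᶻ sumFin g
sum-+ {zero}  f g = refl
sum-+ {suc N} f g = begin
  (f F.zero +ᶻ g F.zero) +ᶻ sumFin (λ i → f (F.suc i) +ᶻ g (F.suc i))
    ≡⟨ cong ((f F.zero +ᶻ g F.zero) +ᶻ_) (sum-+ (f ∘ F.suc) (g ∘ F.suc)) ⟩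
  (f F.zero +ᶻ g F.zero) +ᶻ (sumFin (f ∘ F.suc) +ᶻ sumFin (g ∘ F.suc))
    ≡⟨ interchange (f F.zero) (g F.zero) (sumFin (f ∘ F.suc)) (sumFin (g ∘ F.suc)) ⟩
  (f F.zero +ᶻ sumFin (f ∘ F.suc)) +ᶻ (g F.zero +ᶻ sumFin (g ∘ F.suc)) ∎
  where
  open ≡-Reasoning
  interchange : ∀ a b c d → (a +ᶻ b) +ᶻ (c +ᶻ d) ≡ (a +ᶻ c) +ᶻ (b +ᶻ d)
  interchange = solve-∀

sum-*ˡ : ∀ {N} (c : ℤ) (f : ℤ^ N) → sumFin (λ i → c *ᶻ f i) ≡ c *ᶻ sumFin f
sum-*ˡ {zero}  c f = sym (ZP.*-zeroʳ c)
sum-*ˡ {suc N} c f = trans (cong (c *ᶻ f F.zero +ᶻ_) (sum-*ˡ c (f ∘ F.suc)))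
                           (sym (ZP.*-distribˡ-+ c (f F.zero) _))

sum-*ʳ : ∀ {N} (c : ℤ) (f : ℤ^ N) → sumFin (λ i → f i *ᶻ c) ≡ sumFin f *ᶻ c
sum-*ʳ c f = trans (sum-cong (λ i → ZP.*-comm (f i) c))
                   (trans (sum-*ˡ c f) (ZP.*-comm c _))

sum-neg : ∀ {N} (f : ℤ^ N) → sumFin (λ i → -ᶻ f i) ≡ -ᶻ sumFin f
sum-neg {zero}  f = refl
sum-neg {suc N} f = trans (cong (-ᶻ f F.zero +ᶻ_) (sum-neg (f ∘ F.suc)))
                          (sym (ZP.neg-distrib-+ (f F.zero) _))

sum-- : ∀ {N} (f g : ℤ^ N) → sumFin (λ i → f i -ᶻ g i) ≡ sumFin f -ᶻ sumFin g
sum-- f g = trans (sum-+ f (λ i → -ᶻ g i)) (cong (sumFin f +ᶻ_) (sum-neg g))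

sum-swap : ∀ {M N} (f : Fin M → Fin N → ℤ) →
  sumFin (λ i → sumFin (λ j → f i j)) ≡ sumFin (λ j → sumFin (λ i → f i j))
sum-swap {zero}  {N} f = sym (sum-zero {N})
sum-swap {suc M} {N} f = begin
  sumFin (f F.zero) +ᶻ sumFin (λ i → sumFin (f (F.suc i)))
    ≡⟨ cong (sumFin (f F.zero) +ᶻ_) (sum-swap (f ∘ F.suc)) ⟩
  sumFin (f F.zero) +ᶻ sumFin (λ j → sumFin (λ i → f (F.suc i) j))
    ≡⟨ sym (sum-+ (f F.zero) (λ j → sumFin (λ i → f (F.suc i) j))) ⟩
  sumFin (λ j → f F.zero j +ᶻ sumFin (λ i → f (F.suc i) j)) ∎
  where open ≡-Reasoning

δ-refl : ∀ {N} (i : Fin N) → idMat i i ≡ + 1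
δ-refl i with i F.≟ i
... | yes _ = refl
... | no i≢i = ⊥-elim (i≢i refl)

δ-≢ : ∀ {N} (i j : Fin N) → i ≢ j → idMat i j ≡ + 0
δ-≢ i j i≢j with i F.≟ j
... | yes i≡j = ⊥-elim (i≢j i≡j)
... | no _ = refl

sum-δ : ∀ {N} (i : Fin N) (f : ℤ^ N) → sumFin (λ j → idMat i j *ᶻ f j) ≡ f i
sum-δ {suc N} F.zero f = begin
  + 1 *ᶻ f F.zero +ᶻ sumFin (λ j → idMat F.zero (F.suc j) *ᶻ f (F.suc j))
    ≡⟨ cong₂ _+ᶻ_ (ZP.*-identityˡ (f F.zero))
        (trans (sum-cong (λ j → ZP.*-zeroˡ (f (F.suc j)))) (sum-zero {N})) ⟩
  f F.zero +ᶻ + 0 ≡⟨ ZP.+-identityʳ _ ⟩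
  f F.zero ∎
  where open ≡-Reasoning
sum-δ {suc N} (F.suc i) f = begin
  + 0 *ᶻ f F.zero +ᶻ sumFin (λ j → idMat (F.suc i) (F.suc j) *ᶻ f (F.suc j))
    ≡⟨ ZP.+-identityˡ _ ⟩
  sumFin (λ j → idMat i j *ᶻ f (F.suc j)) ≡⟨ sum-δ i (f ∘ F.suc) ⟩
  f (F.suc i) ∎
  where open ≡-Reasoning

·-cong : ∀ {N} (A : Mat N) {u v : ℤ^ N} → (∀ j → u j ≡ v j) → ∀ i → (A · u) i ≡ (A · v) i
·-cong A e i = sum-cong (λ j → cong (A i j *ᶻ_) (e j))

·-congˡ : ∀ {N} {A B : Mat N} (v : ℤ^ N) → (∀ i j → A i j ≡ B i j) → ∀ i → (A · v) i ≡ (B · v) i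
·-congˡ v e i = sum-cong (λ j → cong (_*ᶻ v j) (e i j))

·-⊗ : ∀ {N} (A B : Mat N) (v : ℤ^ N) → ∀ i → ((A ⊗ B) · v) i ≡ (A · B · v) i
·-⊗ A B v i = begin
  sumFin (λ k → sumFin (λ j → A i j *ᶻ B j k) *ᶻ v k)
    ≡⟨ sum-cong (λ k → sym (sum-*ʳ (v k) (λ j → A i j *ᶻ B j k))) ⟩
  sumFin (λ k → sumFin (λ j → A i j *ᶻ B j k *ᶻ v k))
    ≡⟨ sum-swap (λ k j → A i j *ᶻ B j k *ᶻ v k) ⟩
  sumFin (λ j → sumFin (λ k → A i j *ᶻ B j k *ᶻ v k))
    ≡⟨ sum-cong (λ j → trans (sum-cong (λ k → ZP.*-assoc (A i j) (B j k) (v k)))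
                              (sum-*ˡ (A i j) (λ k → B j k *ᶻ v k))) ⟩
  sumFin (λ j → A i j *ᶻ sumFin (λ k → B j k *ᶻ v k)) ∎
  where open ≡-Reasoning

·-+ : ∀ {N} (A : Mat N) (u v : ℤ^ N) i → (A · (λ j → u j +ᶻ v j)) i ≡ (A · u) i +ᶻ (A · v) i
·-+ A u v i = trans (sum-cong (λ j → ZP.*-distribˡ-+ (A i j) (u j) (v j)))
                    (sum-+ (λ j → A i j *ᶻ u j) (λ j → A i j *ᶻ v j))

·-scale : ∀ {N} (A : Mat N) (c : ℤ) (v : ℤ^ N) i → (A · (λ j → c *ᶻ v j)) i ≡ c *ᶻ (A · v) i
·-scale A c v i = trans (sum-cong (λ j → swap (A i j) c (v j))) (sum-*ˡ c (λ j → A i j *ᶻ v j))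
  where
  swap : ∀ a c v → a *ᶻ (c *ᶻ v) ≡ c *ᶻ (a *ᶻ v)
  swap = solve-∀

·-- : ∀ {N} (A : Mat N) (u v : ℤ^ N) i → (A · (λ j → u j -ᶻ v j)) i ≡ (A · u) i -ᶻ (A · v) i
·-- A u v i = begin
  sumFin (λ j → A i j *ᶻ (u j -ᶻ v j))
    ≡⟨ sum-cong (λ j → distrib (A i j) (u j) (v j)) ⟩
  sumFin (λ j → A i j *ᶻ u j -ᶻ A i j *ᶻ v j)
    ≡⟨ sum-- (λ j → A i j *ᶻ u j) (λ j → A i j *ᶻ v j) ⟩
  (A · u) i -ᶻ (A · v) i ∎
  where
  open ≡-Reasoning
  distrib : ∀ a u v → a *ᶻ (u -ᶻ v) ≡ a *ᶻ u -ᶻ a *ᶻ v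
  distrib = solve-∀

·-zero : ∀ {N} (A : Mat N) i → (A · (λ _ → + 0)) i ≡ + 0
·-zero {N} A i = trans (sum-cong (λ j → ZP.*-zeroʳ (A i j))) (sum-zero {N})

inverse-cancel : ∀ {N} (A B : Mat N) → (∀ i j → (A ⊗ B) i j ≡ idMat i j) →
  ∀ v i → (A · B · v) i ≡ v i
inverse-cancel A B AB≡I v i =
  trans (sym (·-⊗ A B v i)) (trans (·-congˡ v AB≡I i) (sum-δ i v))

pad : ∀ {M} → (Fin M → ℤ) → ℤ^ (suc M)
pad {M} x i with toℕ i N.<? M
... | yes i<M = x (fromℕ< i<M)
... | no _ = + 0

-- The free coordinate of ℤ^(1+M).
last : ∀ M → Fin (suc M)
last = F.fromℕ

pad-inject : ∀ {M} (x : Fin M → ℤ) (j : Fin M) → pad x (F.inject₁ j) ≡ x j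
pad-inject {M} x j with toℕ (F.inject₁ j) N.<? M
... | yes p = cong x (FP.toℕ-injective (trans (FP.toℕ-fromℕ< p) (FP.toℕ-inject₁ j)))
... | no ¬p = ⊥-elim (¬p (subst (N._< M) (sym (FP.toℕ-inject₁ j)) (FP.toℕ<n j)))

pad-last : ∀ {M} (x : Fin M → ℤ) → pad x (last M) ≡ + 0
pad-last {M} x with toℕ (last M) N.<? M
... | yes p = ⊥-elim (NP.<-irrefl (FP.toℕ-fromℕ M) p)
... | no _ = refl

pad-map₂ : ∀ {M} (_∙_ : ℤ → ℤ → ℤ) → (+ 0) ∙ (+ 0) ≡ + 0 → (a b : Fin M → ℤ) →
  ∀ i → pad (λ j → a j ∙ b j) i ≡ pad a i ∙ pad b i
pad-map₂ {M} _∙_ zero∙zero a b i with toℕ i N.<? M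
... | yes _ = refl
... | no _ = sym zero∙zero

pad-scale : ∀ {M} (c : ℤ) (d : Fin M → ℤ) i → pad (λ j → c *ᶻ d j) i ≡ c *ᶻ pad d i
pad-scale {M} c d i with toℕ i N.<? M
... | yes _ = refl
... | no _ = sym (ZP.*-zeroʳ c)

pad-cong : ∀ {M} {a b : Fin M → ℤ} → (∀ j → a j ≡ b j) → ∀ i → pad a i ≡ pad b i
pad-cong {M} a≡b i with toℕ i N.<? M
... | yes p = a≡b (fromℕ< p)
... | no _ = refl

vanishing-last⇒pad : ∀ {M} (v : ℤ^ (suc M)) → v (last M) ≡ + 0 →
  ∀ i → v i ≡ pad (v ∘ F.inject₁) i
vanishing-last⇒pad {M} v v-last i with toℕ i N.<? M
... | yes p = cong v (FP.toℕ-injective (sym (trans (FP.toℕ-inject₁ (fromℕ< p)) (FP.toℕ-fromℕ< p))))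
... | no ¬p = trans (cong v (FP.toℕ-injective (trans i≡M (sym (FP.toℕ-fromℕ M))))) v-last
  where
  i≡M : toℕ i ≡ M
  i≡M = NP.≤-antisym (NP.<⇒≤pred (FP.toℕ<n i)) (NP.≮⇒≥ ¬p)

inject₁≢last : ∀ {M} (j : Fin M) → F.inject₁ j ≢ last M
inject₁≢last {M} j e = NP.<-irrefl (FP.toℕ-fromℕ M)
   (subst (N._< M) (trans (sym (FP.toℕ-inject₁ j)) (cong toℕ e)) (FP.toℕ<n j))

snfDiag-δ : ∀ {M} (t : Fin M → ℕ) (i k : Fin (suc M)) →
  snfDiag {suc M} t i k ≡ idMat i k *ᶻ pad (λ j → + t j) i
snfDiag-δ {M} t i k with i F.≟ k | toℕ i N.<? M
... | yes refl | yes p = sym (ZP.*-identityˡ _)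
... | yes refl | no _  = refl
... | no _     | yes p = refl
... | no _     | no _  = refl

snfDiag-· : ∀ {M} (t : Fin M → ℕ) (u : ℤ^ (suc M)) i →
  (snfDiag {suc M} t · u) i ≡ pad (λ j → + t j) i *ᶻ u i
snfDiag-· t u i = begin
  sumFin (λ k → snfDiag t i k *ᶻ u k)
    ≡⟨ sum-cong (λ k → trans (cong (_*ᶻ u k) (snfDiag-δ t i k))
                             (ZP.*-assoc (idMat i k) (pad (λ j → + t j) i) (u k))) ⟩
  sumFin (λ k → idMat i k *ᶻ (pad (λ j → + t j) i *ᶻ u k))
    ≡⟨ sum-δ i (λ k → pad (λ j → + t j) i *ᶻ u k) ⟩
  pad (λ j → + t j) i *ᶻ u i ∎
  where open ≡-Reasoning

pad∈Im-snfDiag : ∀ {M} (t : Fin M → ℕ) (d : Fin M → ℤ) → (∀ j → (+ t j) ZS.∣ d j) →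
  pad d ∈Im snfDiag {suc M} t
pad∈Im-snfDiag t d t∣d = image (pad q) λ i → begin
  pad d i                                ≡⟨ pad-cong d≡tq i ⟩
  pad (λ j → + t j *ᶻ q j) i             ≡⟨ pad-map₂ _*ᶻ_ refl (λ j → + t j) q i ⟩
  pad (λ j → + t j) i *ᶻ pad q i         ≡⟨ sym (snfDiag-· t (pad q) i) ⟩
  (snfDiag t · pad q) i ∎
  where
  open ≡-Reasoning
  q : Fin _ → ℤ
  q j = ZS.quotient (t∣d j)
  d≡tq : ∀ j → d j ≡ + t j *ᶻ q j
  d≡tq j = trans (ZS._∣_.equality (t∣d j)) (ZP.*-comm (q j) (+ t j))

∈Im-snfDiag⇒divisible : ∀ {M} (t : Fin M → ℕ) {v : ℤ^ (suc M)} → v ∈Im snfDiag {suc M} t →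
  ∀ j → (+ t j) ZS.∣ v (F.inject₁ j)
∈Im-snfDiag⇒divisible t (image u v≡Du) j = ZS.divides (u (F.inject₁ j)) (begin
  _ ≡⟨ v≡Du (F.inject₁ j) ⟩
  (snfDiag t · u) (F.inject₁ j) ≡⟨ snfDiag-· t u (F.inject₁ j) ⟩
  pad (λ j → + t j) (F.inject₁ j) *ᶻ u (F.inject₁ j)
    ≡⟨ cong (_*ᶻ u (F.inject₁ j)) (pad-inject (λ j → + t j) j) ⟩
  + t j *ᶻ u (F.inject₁ j) ≡⟨ ZP.*-comm (+ t j) _ ⟩
  u (F.inject₁ j) *ᶻ + t j ∎)
  where open ≡-Reasoning

∈Im-snfDiag⇒last≡0 : ∀ {M} (t : Fin M → ℕ) {v : ℤ^ (suc M)} → v ∈Im snfDiag {suc M} t →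
  v (last M) ≡ + 0
∈Im-snfDiag⇒last≡0 {M} t (image u v≡Du) = begin
  _ ≡⟨ v≡Du (last M) ⟩
  (snfDiag t · u) (last M) ≡⟨ snfDiag-· t u (last M) ⟩
  pad (λ j → + t j) (last M) *ᶻ u (last M) ≡⟨ cong (_*ᶻ u (last M)) (pad-last (λ j → + t j)) ⟩
  + 0 ∎
  where open ≡-Reasoning

cancel-nonzero : ∀ T (v : ℤ) → T ≢ 0 → + T *ᶻ v ≡ + 0 → v ≡ + 0
cancel-nonzero T v T≢0 Tv≡0 with ZP.i*j≡0⇒i≡0∨j≡0 (+ T) Tv≡0
... | inj₁ T≡0 = ⊥-elim (T≢0 (ZP.+-injective T≡0))
... | inj₂ v≡0 = v≡0

∏ : ∀ {M} → (Fin M → ℕ) → ℕ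
∏ {zero}  t = 1
∏ {suc M} t = t F.zero N.* ∏ (t ∘ F.suc)

∣∏ : ∀ {M} (t : Fin M → ℕ) j → t j ∣ ∏ t
∣∏ {suc M} t F.zero    = NDv.m∣m*n (∏ (t ∘ F.suc))
∣∏ {suc M} t (F.suc j) = NDv.∣-trans (∣∏ (t ∘ F.suc) j) (NDv.n∣m*n (t F.zero))

∏≢0 : ∀ {M} (t : Fin M → ℕ) → (∀ j → t j ≢ 0) → ∏ t ≢ 0
∏≢0 {zero}  t t≢0 ()
∏≢0 {suc M} t t≢0 ∏≡0 with NP.m*n≡0⇒m≡0∨n≡0 (t F.zero) ∏≡0
... | inj₁ t₀≡0 = t≢0 F.zero t₀≡0
... | inj₂ rest≡0 = ∏≢0 (t ∘ F.suc) (t≢0 ∘ F.suc) rest≡0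

module SmithForm {M : ℕ} (L : Mat (suc M)) (t : Fin M → ℕ) (snf : IsSNF L t) where

  D : Mat (suc M)
  D = snfDiag t

  P Q P⁻¹ Q⁻¹ : Mat (suc M)
  P = proj₁ (proj₂ snf)
  Q = proj₁ (proj₂ (proj₂ snf))
  P⁻¹ = proj₁ (proj₁ (proj₂ (proj₂ (proj₂ snf))))
  Q⁻¹ = proj₁ (proj₁ (proj₂ (proj₂ (proj₂ (proj₂ snf)))))

  PP⁻¹≡I : ∀ i j → (P ⊗ P⁻¹) i j ≡ idMat i j
  PP⁻¹≡I = proj₁ (proj₂ (proj₁ (proj₂ (proj₂ (proj₂ snf)))))
  P⁻¹P≡I : ∀ i j → (P⁻¹ ⊗ P) i j ≡ idMat i j
  P⁻¹P≡I = proj₂ (proj₂ (proj₁ (proj₂ (proj₂ (proj₂ snf)))))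
  QQ⁻¹≡I : ∀ i j → (Q ⊗ Q⁻¹) i j ≡ idMat i j
  QQ⁻¹≡I = proj₁ (proj₂ (proj₁ (proj₂ (proj₂ (proj₂ (proj₂ snf))))))
  Q⁻¹Q≡I : ∀ i j → (Q⁻¹ ⊗ Q) i j ≡ idMat i j
  Q⁻¹Q≡I = proj₂ (proj₂ (proj₁ (proj₂ (proj₂ (proj₂ (proj₂ snf))))))

  PLQ≡D : ∀ i j → ((P ⊗ L) ⊗ Q) i j ≡ D i j
  PLQ≡D = proj₂ (proj₂ (proj₂ (proj₂ (proj₂ snf))))

  D≡PLQ : ∀ u i → (D · u) i ≡ (P · L · Q · u) i
  D≡PLQ u i = trans (sym (·-congˡ u PLQ≡D i))
                    (trans (·-⊗ (P ⊗ L) Q u i) (·-⊗ P L (Q · u) i))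

  LQ≡P⁻¹D : ∀ u i → (L · Q · u) i ≡ (P⁻¹ · D · u) i
  LQ≡P⁻¹D u i = trans (sym (inverse-cancel P⁻¹ P P⁻¹P≡I (L · Q · u) i))
                      (·-cong P⁻¹ (λ j → sym (D≡PLQ u j)) i)

  PL≡DQ⁻¹ : ∀ y i → (P · L · y) i ≡ (D · Q⁻¹ · y) i
  PL≡DQ⁻¹ y i = trans (·-cong P (·-cong L (λ k → sym (inverse-cancel Q Q⁻¹ QQ⁻¹≡I y k))) i)
                      (sym (D≡PLQ (Q⁻¹ · y) i))

  -- P identifies the cokernel of L with that of D.
  Im-L⇒Im-D : ∀ {y} → y ∈Im L → (P · y) ∈Im D
  Im-L⇒Im-D (image w y≡Lw) = image (Q⁻¹ · w) λ i → trans (·-cong P y≡Lw i) (PL≡DQ⁻¹ w i)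

  Im-D⇒Im-L : ∀ {y} → (P · y) ∈Im D → y ∈Im L
  Im-D⇒Im-L {y} (image u Py≡Du) = image (Q · u) λ i → begin
    y i                ≡⟨ sym (inverse-cancel P⁻¹ P P⁻¹P≡I y i) ⟩
    (P⁻¹ · P · y) i    ≡⟨ ·-cong P⁻¹ Py≡Du i ⟩
    (P⁻¹ · D · u) i    ≡⟨ sym (LQ≡P⁻¹D u i) ⟩
    (L · Q · u) i ∎
    where open ≡-Reasoning

  Q-injective : ∀ w → (∀ i → (Q · w) i ≡ + 0) → ∀ i → w i ≡ + 0
  Q-injective w Qw≡0 i = trans (sym (inverse-cancel Q⁻¹ Q Q⁻¹Q≡I w i))
                               (trans (·-cong Q⁻¹ Qw≡0 i) (·-zero Q⁻¹ i))

  unit : Fin (suc M) → ℤ^ (suc M)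
  unit k i = idMat i k

  Q-unit∈ker : ∀ k → pad (λ j → + t j) k ≡ + 0 → ∀ x → (L · Q · unit k) x ≡ + 0
  Q-unit∈ker k t-k≡0 x =
    trans (LQ≡P⁻¹D (unit k) x) (trans (·-cong P⁻¹ D-unit≡0 x) (·-zero P⁻¹ x))
    where
    D-unit≡0 : ∀ i → (D · unit k) i ≡ + 0
    D-unit≡0 i with i F.≟ k
    ... | yes refl = trans (snfDiag-· t (unit i) i)
                           (trans (cong (_*ᶻ idMat i i) t-k≡0) (ZP.*-zeroˡ (idMat i i)))
    ... | no i≢k = trans (snfDiag-· t (unit k) i)
                         (trans (cong (pad (λ j → + t j) i *ᶻ_) (δ-≢ i k i≢k))
                                (ZP.*-zeroʳ (pad (λ j → + t j) i)))

  -- Q cannot send two distinct unit vectors e_k, e_ℓ to constant vectors cₖ, cℓ: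
  -- then cℓ eₖ - cₖ eℓ would lie in ker Q = 0, forcing cₖ = 0 and eₖ = 0.
  no-two-constant-images : ∀ k ℓ cₖ cℓ → ℓ ≢ k →
    (∀ x → (Q · unit k) x ≡ cₖ) → (∀ x → (Q · unit ℓ) x ≡ cℓ) → ⊥
  no-two-constant-images k ℓ cₖ cℓ ℓ≢k Qe≡cₖ Qe≡cℓ = 1≢0 (begin
    + 1                      ≡⟨ sym (δ-refl k) ⟩
    unit k k                 ≡⟨ Q-injective (unit k) Qe≡0 k ⟩
    + 0 ∎)
    where
    open ≡-Reasoning
    1≢0 : + 1 ≢ + 0
    1≢0 ()
    w : ℤ^ (suc M)
    w i = cℓ *ᶻ unit k i -ᶻ cₖ *ᶻ unit ℓ i
    Qw≡0 : ∀ x → (Q · w) x ≡ + 0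
    Qw≡0 x = begin
      (Q · w) x
        ≡⟨ ·-- Q (λ i → cℓ *ᶻ unit k i) (λ i → cₖ *ᶻ unit ℓ i) x ⟩
      (Q · (λ i → cℓ *ᶻ unit k i)) x -ᶻ (Q · (λ i → cₖ *ᶻ unit ℓ i)) x
        ≡⟨ cong₂ _-ᶻ_ (·-scale Q cℓ (unit k) x) (·-scale Q cₖ (unit ℓ) x) ⟩
      cℓ *ᶻ (Q · unit k) x -ᶻ cₖ *ᶻ (Q · unit ℓ) x
        ≡⟨ cong₂ (λ a b → cℓ *ᶻ a -ᶻ cₖ *ᶻ b) (Qe≡cₖ x) (Qe≡cℓ x) ⟩
      cℓ *ᶻ cₖ -ᶻ cₖ *ᶻ cℓ
        ≡⟨ cancel cℓ cₖ ⟩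
      + 0 ∎
      where
      cancel : ∀ a b → a *ᶻ b -ᶻ b *ᶻ a ≡ + 0
      cancel = solve-∀
    cₖ≡0 : cₖ ≡ + 0
    cₖ≡0 = begin
      cₖ                                      ≡⟨ negate cₖ cℓ ⟩
      -ᶻ (cℓ *ᶻ + 0 -ᶻ cₖ *ᶻ + 1)              ≡⟨ cong₂ (λ a b → -ᶻ (cℓ *ᶻ a -ᶻ cₖ *ᶻ b))
                                                   (sym (δ-≢ ℓ k ℓ≢k)) (sym (δ-refl ℓ)) ⟩
      -ᶻ w ℓ                                  ≡⟨ cong -ᶻ_ (Q-injective w Qw≡0 ℓ) ⟩
      + 0 ∎
      where
      negate : ∀ c d → c ≡ -ᶻ (d *ᶻ + 0 -ᶻ c *ᶻ + 1)
      negate = solve-∀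
    Qe≡0 : ∀ x → (Q · unit k) x ≡ + 0
    Qe≡0 x = trans (Qe≡cₖ x) cₖ≡0

  -- When ker L consists of the constants, D has rank N-1: all invariants t j are
  -- nonzero.  Otherwise both e_j and the last unit vector would be sent into ker L.
  invariants-nonzero : ConstantKernel L → ∀ j → t j ≢ 0
  invariants-nonzero constKer j t-j≡0 =
    no-two-constant-images k ℓ _ _ (inject₁≢last j ∘ sym)
      (Qe≡c k (trans (pad-inject (λ j → + t j) j) (cong +_ t-j≡0)))
      (Qe≡c ℓ (pad-last (λ j → + t j)))
    where
    k ℓ : Fin (suc M)
    k = F.inject₁ j
    ℓ = last M
    Qe≡c : ∀ m → pad (λ j → + t j) m ≡ + 0 → ∀ x → (Q · unit m) x ≡ (Q · unit m) F.zero
    Qe≡c m t-m≡0 x = constKer (Q · unit m) (Q-unit∈ker m t-m≡0) x F.zero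

record Covering {N₁ N₂ : ℕ} (L₁ : Mat N₁) (L₂ : Mat N₂) : Set where
  field
    π         : Fin N₂ → Fin N₁
    section   : Fin N₁ → Fin N₂
    π∘section : ∀ x → π (section x) ≡ x
    pullback-commutes : ∀ (f : ℤ^ N₁) x → (L₂ · (f ∘ π)) x ≡ (L₁ · f) (π x)
    descent : ∀ (z : ℤ^ N₂) (y : ℤ^ N₁) → (∀ x → (L₂ · z) x ≡ y (π x)) →
              Σ (ℤ^ N₁) λ w → ∀ x → z x ≡ w (π x)

  pullback-preserves-Im : ∀ {y} → y ∈Im L₁ → (y ∘ π) ∈Im L₂
  pullback-preserves-Im (image w y≡Lw) = image (w ∘ π) λ x →
    trans (y≡Lw (π x)) (sym (pullback-commutes w x))

  pullback-reflects-Im : ∀ {y} → (y ∘ π) ∈Im L₂ → y ∈Im L₁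
  pullback-reflects-Im {y} (image z yπ≡Lz) = image w λ x → begin
    y x                          ≡⟨ cong y (sym (π∘section x)) ⟩
    y (π (section x))            ≡⟨ yπ≡Lz (section x) ⟩
    (L₂ · z) (section x)         ≡⟨ ·-cong L₂ z≡wπ (section x) ⟩
    (L₂ · (w ∘ π)) (section x)   ≡⟨ pullback-commutes w (section x) ⟩
    (L₁ · w) (π (section x))     ≡⟨ cong (L₁ · w) (π∘section x) ⟩
    (L₁ · w) x ∎
    where
    open ≡-Reasoning
    descended : Σ (ℤ^ _) λ w → ∀ x → z x ≡ w (π x)
    descended = descent z y (λ x → sym (yπ≡Lz x))
    w = proj₁ descended
    z≡wπ = proj₂ descended

-- In Smith coordinates the
-- embedding is  Φ = P₂ ∘ π* ∘ P₁⁻¹,  restricted to the torsion coordinates.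

module CoveringEmbedding {M₁ M₂ : ℕ} {L₁ : Mat (suc M₁)} {L₂ : Mat (suc M₂)}
  (cov : Covering L₁ L₂) (constKer₁ : ConstantKernel L₁)
  {t₁ : Fin M₁ → ℕ} {t₂ : Fin M₂ → ℕ} (snf₁ : IsSNF L₁ t₁) (snf₂ : IsSNF L₂ t₂) where

  open Covering cov
  module S₁ = SmithForm L₁ t₁ snf₁
  module S₂ = SmithForm L₂ t₂ snf₂

  Φ : ℤ^ (suc M₁) → ℤ^ (suc M₂)
  Φ e = S₂.P · ((S₁.P⁻¹ · e) ∘ π)

  Φ-cong : ∀ {e e'} → (∀ k → e k ≡ e' k) → ∀ i → Φ e i ≡ Φ e' i
  Φ-cong e≡e' = ·-cong S₂.P (λ x → ·-cong S₁.P⁻¹ e≡e' (π x))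

  Φ-+ : ∀ e e' i → Φ (λ k → e k +ᶻ e' k) i ≡ Φ e i +ᶻ Φ e' i
  Φ-+ e e' i = trans (·-cong S₂.P (λ x → ·-+ S₁.P⁻¹ e e' (π x)) i)
                     (·-+ S₂.P ((S₁.P⁻¹ · e) ∘ π) ((S₁.P⁻¹ · e') ∘ π) i)

  Φ-- : ∀ e e' i → Φ (λ k → e k -ᶻ e' k) i ≡ Φ e i -ᶻ Φ e' i
  Φ-- e e' i = trans (·-cong S₂.P (λ x → ·-- S₁.P⁻¹ e e' (π x)) i)
                     (·-- S₂.P ((S₁.P⁻¹ · e) ∘ π) ((S₁.P⁻¹ · e') ∘ π) i)

  Φ-scale : ∀ c e i → Φ (λ k → c *ᶻ e k) i ≡ c *ᶻ Φ e i
  Φ-scale c e i = trans (·-cong S₂.P (λ x → ·-scale S₁.P⁻¹ c e (π x)) i)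
                        (·-scale S₂.P c ((S₁.P⁻¹ · e) ∘ π) i)

  P⁻¹-Im-D⇒Im-L : ∀ {e} → e ∈Im S₁.D → (S₁.P⁻¹ · e) ∈Im L₁
  P⁻¹-Im-D⇒Im-L {e} e∈ImD = S₁.Im-D⇒Im-L
    (∈Im-cong (λ i → sym (inverse-cancel S₁.P S₁.P⁻¹ S₁.PP⁻¹≡I e i)) e∈ImD)

  P⁻¹-Im-L⇒Im-D : ∀ {e} → (S₁.P⁻¹ · e) ∈Im L₁ → e ∈Im S₁.D
  P⁻¹-Im-L⇒Im-D {e} P⁻¹e∈ImL =
    ∈Im-cong (inverse-cancel S₁.P S₁.P⁻¹ S₁.PP⁻¹≡I e) (S₁.Im-L⇒Im-D P⁻¹e∈ImL)

  Φ-preserves-Im : ∀ {e} → e ∈Im S₁.D → Φ e ∈Im S₂.D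
  Φ-preserves-Im = S₂.Im-L⇒Im-D ∘ pullback-preserves-Im ∘ P⁻¹-Im-D⇒Im-L

  Φ-reflects-Im : ∀ {e} → Φ e ∈Im S₂.D → e ∈Im S₁.D
  Φ-reflects-Im = P⁻¹-Im-L⇒Im-D ∘ pullback-reflects-Im ∘ S₂.Im-D⇒Im-L

  -- The torsion part is mapped into the torsion part: the free (last) Smith
  -- coordinate of Φ (pad d) vanishes, because ∏ t₁ · pad d lies in im D₁.
  Φ-pad-last : ∀ d → Φ (pad d) (last M₂) ≡ + 0
  Φ-pad-last d = cancel-nonzero T (Φ (pad d) (last M₂)) T≢0 (begin
    + T *ᶻ Φ (pad d) (last M₂)          ≡⟨ sym (Φ-scale (+ T) (pad d) (last M₂)) ⟩
    Φ (λ k → + T *ᶻ pad d k) (last M₂)  ≡⟨ ∈Im-snfDiag⇒last≡0 t₂ (Φ-preserves-Im Td∈ImD) ⟩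
    + 0 ∎)
    where
    open ≡-Reasoning
    T : ℕ
    T = ∏ t₁
    T≢0 : T ≢ 0
    T≢0 = ∏≢0 t₁ (S₁.invariants-nonzero constKer₁)
    Td∈ImD : (λ k → + T *ᶻ pad d k) ∈Im S₁.D
    Td∈ImD = ∈Im-cong (pad-scale (+ T) d)
      (pad∈Im-snfDiag t₁ (λ j → + T *ᶻ d j)
         (λ j → ZS.∣m⇒∣m*n (d j) (ZS.∣ᵤ⇒∣ {+ t₁ j} {+ T} (∣∏ t₁ j))))

  φ : (Fin M₁ → ℤ) → (Fin M₂ → ℤ)
  φ x j = Φ (pad x) (F.inject₁ j)

  φ-- : ∀ x x' j → φ x j -ᶻ φ x' j ≡ Φ (pad (λ k → x k -ᶻ x' k)) (F.inject₁ j)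
  φ-- x x' j = sym (trans (Φ-cong (pad-map₂ _-ᶻ_ refl x x') (F.inject₁ j))
                          (Φ-- (pad x) (pad x') (F.inject₁ j)))

  -- Congruent inputs differ by an element of im D₁, which Φ sends into im D₂.
  φ-well-defined : ∀ x x' → x ≈[ t₁ ] x' → φ x ≈[ t₂ ] φ x'
  φ-well-defined x x' x≈x' j = ZS.∣⇒∣ᵤ (subst (ZS._∣_ (+ t₂ j)) (sym (φ-- x x' j))
    (∈Im-snfDiag⇒divisible t₂ (Φ-preserves-Im
       (pad∈Im-snfDiag t₁ (λ k → x k -ᶻ x' k) (ZS.∣ᵤ⇒∣ ∘ x≈x'))) j))

  -- φ is additive on the nose, since Φ and pad are.
  φ-homomorphism : ∀ x y → φ (λ i → x i +ᶻ y i) ≈[ t₂ ] (λ j → φ x j +ᶻ φ y j)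
  φ-homomorphism x y j = ZS.∣⇒∣ᵤ {+ t₂ j} (ZS.divides (+ 0) (begin
    φ (λ i → x i +ᶻ y i) j -ᶻ (φ x j +ᶻ φ y j)
      ≡⟨ cong (_-ᶻ (φ x j +ᶻ φ y j)) (trans (Φ-cong (pad-map₂ _+ᶻ_ refl x y) (F.inject₁ j))
                                             (Φ-+ (pad x) (pad y) (F.inject₁ j))) ⟩
    (φ x j +ᶻ φ y j) -ᶻ (φ x j +ᶻ φ y j)  ≡⟨ ZP.+-inverseʳ (φ x j +ᶻ φ y j) ⟩
    + 0                                   ≡⟨ sym (ZP.*-zeroˡ (+ t₂ j)) ⟩
    + 0 *ᶻ + t₂ j ∎))
    where open ≡-Reasoning

  -- Injectivity: if φ x ≡ φ x' then v = Φ (pad (x - x')) has torsion coordinates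
  -- divisible by t₂ and vanishing free coordinate, so v ∈ im D₂ and pad (x - x') ∈ im D₁.
  φ-injective : ∀ x x' → φ x ≈[ t₂ ] φ x' → x ≈[ t₁ ] x'
  φ-injective x x' φx≈φx' j = ZS.∣⇒∣ᵤ (subst (ZS._∣_ (+ t₁ j)) (pad-inject d j)
    (∈Im-snfDiag⇒divisible t₁ (Φ-reflects-Im {pad d} v∈ImD) j))
    where
    d : Fin M₁ → ℤ
    d k = x k -ᶻ x' k
    v : ℤ^ (suc M₂)
    v = Φ (pad d)
    v∈ImD : v ∈Im S₂.D
    v∈ImD = ∈Im-cong (λ i → sym (vanishing-last⇒pad v (Φ-pad-last d) i))
      (pad∈Im-snfDiag t₂ (v ∘ F.inject₁)
        (λ j → subst (ZS._∣_ (+ t₂ j)) (φ-- x x' j) (ZS.∣ᵤ⇒∣ {+ t₂ j} (φx≈φx' j))))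

  embedding : EmbedsInto t₁ t₂
  embedding = φ , φ-well-defined , φ-homomorphism , φ-injective

%-+ : ∀ m .{{_ : NonZero m}} a c → (a % m N.+ c) % m ≡ (a N.+ c) % m
%-+ m a c = begin
  (a % m N.+ c) % m               ≡⟨ ND.%-distribˡ-+ (a % m) c m ⟩
  (a % m % m N.+ c % m) % m       ≡⟨ cong (λ r → (r N.+ c % m) % m) (ND.m%n%n≡m%n a m) ⟩
  (a % m N.+ c % m) % m           ≡⟨ sym (ND.%-distribˡ-+ a c m) ⟩
  (a N.+ c) % m ∎
  where open ≡-Reasoning

indicator-⊎ : ∀ {A B : Set} (a? : Dec A) (b? : Dec B) → ¬ (A × B) →
  + (if does (a? ⊎-dec b?) then 1 else 0)
    ≡ (if does a? then + 1 else + 0) +ᶻ (if does b? then + 1 else + 0)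
indicator-⊎ (yes a) (yes b) ¬ab = ⊥-elim (¬ab (a , b))
indicator-⊎ (yes a) (no _)  _   = refl
indicator-⊎ (no _)  (yes b) _   = refl
indicator-⊎ (no _)  (no _)  _   = refl

module CycleGraph (k : ℕ) where

  n : ℕ
  n = suc (suc (suc k))

  succₙ predₙ : ℕ → ℕ
  succₙ i = (i N.+ 1) % n
  predₙ i = (i N.+ (n N.∸ 1)) % n

  next prev : Fin n → Fin n
  next v = (toℕ v N.+ 1) ND.mod n
  prev v = (toℕ v N.+ (n N.∸ 1)) ND.mod n

  toℕ-next : ∀ v → toℕ (next v) ≡ succₙ (toℕ v)
  toℕ-next v = FP.toℕ-fromℕ< (ND.m%n<n (toℕ v N.+ 1) n)

  toℕ-prev : ∀ v → toℕ (prev v) ≡ predₙ (toℕ v)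
  toℕ-prev v = FP.toℕ-fromℕ< (ND.m%n<n (toℕ v N.+ (n N.∸ 1)) n)

  succₙ-< : ∀ {i} → suc i N.< n → succₙ i ≡ suc i
  succₙ-< {i} i+1<n = trans (cong (_% n) (NP.+-comm i 1)) (ND.m<n⇒m%n≡m i+1<n)

  succₙ-wrap : ∀ {i} → suc i ≡ n → succₙ i ≡ 0
  succₙ-wrap {i} i+1≡n = trans (cong (_% n) (trans (NP.+-comm i 1) i+1≡n)) (ND.n%n≡0 n)

  succₙ-predₙ : ∀ {i} → i N.< n → succₙ (predₙ i) ≡ i
  succₙ-predₙ {i} i<n = begin
    (predₙ i N.+ 1) % n              ≡⟨ %-+ n (i N.+ suc (suc k)) 1 ⟩
    (i N.+ suc (suc k) N.+ 1) % n    ≡⟨ cong (_% n) (trans (NP.+-assoc i (suc (suc k)) 1)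
                                                        (cong (i N.+_) (NP.+-comm (suc (suc k)) 1))) ⟩
    (i N.+ n) % n                    ≡⟨ ND.[m+n]%n≡m%n i n ⟩
    i % n                            ≡⟨ ND.m<n⇒m%n≡m i<n ⟩
    i ∎
    where open ≡-Reasoning

  predₙ-succₙ : ∀ {i} → i N.< n → predₙ (succₙ i) ≡ i
  predₙ-succₙ {i} i<n = begin
    (succₙ i N.+ suc (suc k)) % n    ≡⟨ %-+ n (i N.+ 1) (suc (suc k)) ⟩
    (i N.+ 1 N.+ suc (suc k)) % n    ≡⟨ cong (_% n) (NP.+-assoc i 1 (suc (suc k))) ⟩
    (i N.+ n) % n                    ≡⟨ ND.[m+n]%n≡m%n i n ⟩
    i % n                            ≡⟨ ND.m<n⇒m%n≡m i<n ⟩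
    i ∎
    where open ≡-Reasoning

  prev≡⇔next≡ : ∀ v w → prev v ≡ w ⇔ next w ≡ v
  prev≡⇔next≡ v w = mk⇔
    (λ { refl → FP.toℕ-injective (trans (toℕ-next (prev v))
                  (trans (cong succₙ (toℕ-prev v)) (succₙ-predₙ (FP.toℕ<n v)))) })
    (λ { refl → FP.toℕ-injective (trans (toℕ-prev (next w))
                  (trans (cong predₙ (toℕ-next w)) (predₙ-succₙ (FP.toℕ<n w)))) })

  Adjacent : ℕ → ℕ → Set
  Adjacent i j = j ≡ suc i ⊎ i ≡ suc j ⊎ (suc i ≡ n × j ≡ 0) ⊎ (suc j ≡ n × i ≡ 0)

  -- Its decision procedure; its boolean is definitionally cycleAdj n.
  adjacent? : ∀ i j → Dec (Adjacent i j)
  adjacent? i j = j N.≟ suc i ⊎-dec i N.≟ suc j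
                ⊎-dec (suc i N.≟ n ×-dec j N.≟ 0) ⊎-dec (suc j N.≟ n ×-dec i N.≟ 0)

  succₙ-char : ∀ {i j} → i N.< n → j N.< n → (j ≡ suc i ⊎ (suc i ≡ n × j ≡ 0)) ⇔ j ≡ succₙ i
  succₙ-char {i} {j} i<n j<n = mk⇔ to from
    where
    to : j ≡ suc i ⊎ (suc i ≡ n × j ≡ 0) → j ≡ succₙ i
    to (inj₁ refl) = sym (succₙ-< j<n)
    to (inj₂ (i+1≡n , refl)) = sym (succₙ-wrap i+1≡n)
    from : j ≡ succₙ i → j ≡ suc i ⊎ (suc i ≡ n × j ≡ 0)
    from j≡ with suc i N.<? n
    ... | yes i+1<n = inj₁ (trans j≡ (succₙ-< i+1<n))
    ... | no i+1≮n  = inj₂ (i+1≡n , trans j≡ (succₙ-wrap i+1≡n))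
      where i+1≡n = NP.≤-antisym i<n (NP.≮⇒≥ i+1≮n)

  next≡⇔ : ∀ v w → next v ≡ w ⇔ toℕ w ≡ succₙ (toℕ v)
  next≡⇔ v w = mk⇔ (λ { refl → toℕ-next v })
                   (λ w≡ → FP.toℕ-injective (trans (toℕ-next v) (sym w≡)))

  adjacent⇔ : ∀ v w → Adjacent (toℕ v) (toℕ w) ⇔ (next v ≡ w ⊎ prev v ≡ w)
  adjacent⇔ v w = mk⇔ to from
    where
    i<n : toℕ v N.< n
    i<n = FP.toℕ<n v
    j<n : toℕ w N.< n
    j<n = FP.toℕ<n w
    forward : toℕ w ≡ suc (toℕ v) ⊎ (suc (toℕ v) ≡ n × toℕ w ≡ 0) → next v ≡ w
    forward  = Equivalence.from (next≡⇔ v w) ∘ Equivalence.to (succₙ-char i<n j<n)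
    backward : toℕ v ≡ suc (toℕ w) ⊎ (suc (toℕ w) ≡ n × toℕ v ≡ 0) → prev v ≡ w
    backward = Equivalence.from (prev≡⇔next≡ v w) ∘ Equivalence.from (next≡⇔ w v)
             ∘ Equivalence.to (succₙ-char j<n i<n)
    to : Adjacent (toℕ v) (toℕ w) → next v ≡ w ⊎ prev v ≡ w
    to (inj₁ up)                 = inj₁ (forward (inj₁ up))
    to (inj₂ (inj₁ down))        = inj₂ (backward (inj₁ down))
    to (inj₂ (inj₂ (inj₁ wrap))) = inj₁ (forward (inj₂ wrap))
    to (inj₂ (inj₂ (inj₂ wrap))) = inj₂ (backward (inj₂ wrap))
    from : next v ≡ w ⊎ prev v ≡ w → Adjacent (toℕ v) (toℕ w)
    from (inj₁ next≡w) with Equivalence.from (succₙ-char i<n j<n) (Equivalence.to (next≡⇔ v w) next≡w)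
    ... | inj₁ up   = inj₁ up
    ... | inj₂ wrap = inj₂ (inj₂ (inj₁ wrap))
    from (inj₂ prev≡w) with Equivalence.from (succₙ-char j<n i<n)
                              (Equivalence.to (next≡⇔ w v) (Equivalence.to (prev≡⇔next≡ v w) prev≡w))
    ... | inj₁ down = inj₂ (inj₁ down)
    ... | inj₂ wrap = inj₂ (inj₂ (inj₂ wrap))

  -- Since n ≥ 3, the two neighbours of a vertex are distinct.
  2≢n : 2 ≢ n
  2≢n ()

  succₙ²≢id : ∀ {i} → i N.< n → succₙ (succₙ i) ≢ i
  succₙ²≢id {i} i<n with suc i N.<? n
  ... | no i+1≮n = λ e → 2≢n (trans (cong suc (1≡i e)) i+1≡n)
    where
    i+1≡n = NP.≤-antisym i<n (NP.≮⇒≥ i+1≮n)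
    1≡i : succₙ (succₙ i) ≡ i → 1 ≡ i
    1≡i e = trans (sym (succₙ-< (s≤s (s≤s z≤n)))) (trans (cong succₙ (sym (succₙ-wrap i+1≡n))) e)
  ... | yes i+1<n with suc (suc i) N.<? n
  ...   | yes i+2<n = λ e → NP.<⇒≢ (NP.<-trans (NP.n<1+n i) (NP.n<1+n (suc i)))
                                  (trans (sym e) (trans (cong succₙ (succₙ-< i+1<n)) (succₙ-< i+2<n)))
  ...   | no i+2≮n = λ e → 2≢n (trans (cong (λ j → suc (suc j)) (sym (i≡0 e))) i+2≡n)
    where
    i+2≡n = NP.≤-antisym i+1<n (NP.≮⇒≥ i+2≮n)
    i≡0 : succₙ (succₙ i) ≡ i → i ≡ 0
    i≡0 e = trans (sym e) (trans (cong succₙ (succₙ-< i+1<n)) (succₙ-wrap i+2≡n))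

  next≢prev : ∀ v → next v ≢ prev v
  next≢prev v next≡prev = succₙ²≢id (FP.toℕ<n v) (begin
    succₙ (succₙ (toℕ v))     ≡⟨ sym (trans (toℕ-next (next v)) (cong succₙ (toℕ-next v))) ⟩
    toℕ (next (next v))       ≡⟨ cong toℕ (Equivalence.to (prev≡⇔next≡ v (next v)) (sym next≡prev)) ⟩
    toℕ v ∎)
    where open ≡-Reasoning

  not-adjacent-self : ∀ i → ¬ Adjacent i i
  not-adjacent-self i (inj₁ i≡1+i)                 = NP.1+n≢n (sym i≡1+i)
  not-adjacent-self i (inj₂ (inj₁ i≡1+i))          = NP.1+n≢n (sym i≡1+i)
  not-adjacent-self i (inj₂ (inj₂ (inj₁ (() , refl))))
  not-adjacent-self i (inj₂ (inj₂ (inj₂ (() , refl))))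

  cycle-loopless : ∀ v → Cycle n v v ≡ 0
  cycle-loopless v = cong (λ b → if b then 1 else 0)
    (dec-false (adjacent? (toℕ v) (toℕ v)) (not-adjacent-self (toℕ v)))

  cycle-neighbours : ∀ v w → + Cycle n v w ≡ idMat (next v) w +ᶻ idMat (prev v) w
  cycle-neighbours v w = trans
    (cong (λ b → + (if b then 1 else 0))
      (does-⇔ (adjacent⇔ v w) (adjacent? (toℕ v) (toℕ w)) (next v F.≟ w ⊎-dec prev v F.≟ w)))
    (indicator-⊎ (next v F.≟ w) (prev v F.≟ w) (λ (p , q) → next≢prev v (trans p (sym q))))

  sum-over-neighbours : ∀ v (g : ℤ^ n) → sumFin (λ w → + Cycle n v w *ᶻ g w) ≡ g (next v) +ᶻ g (prev v)
  sum-over-neighbours v g = begin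
    sumFin (λ w → + Cycle n v w *ᶻ g w)
      ≡⟨ sum-cong (λ w → trans (cong (_*ᶻ g w) (cycle-neighbours v w))
                               (ZP.*-distribʳ-+ (g w) (idMat (next v) w) (idMat (prev v) w))) ⟩
    sumFin (λ w → idMat (next v) w *ᶻ g w +ᶻ idMat (prev v) w *ᶻ g w)
      ≡⟨ sum-+ (λ w → idMat (next v) w *ᶻ g w) (λ w → idMat (prev v) w *ᶻ g w) ⟩
    _ ≡⟨ cong₂ _+ᶻ_ (sum-δ (next v) g) (sum-δ (prev v) g) ⟩
    g (next v) +ᶻ g (prev v) ∎
    where open ≡-Reasoning

sum-split : ∀ {m n} (f : ℤ^ (m N.+ n)) →
  sumFin f ≡ sumFin (λ i → f (i F.↑ˡ n)) +ᶻ sumFin (λ j → f (m F.↑ʳ j))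
sum-split {zero}      f = sym (ZP.+-identityˡ _)
sum-split {suc m} {n} f = trans (cong (f F.zero +ᶻ_) (sum-split {m} {n} (f ∘ F.suc)))
  (sym (ZP.+-assoc (f F.zero) (sumFin (λ i → f (F.suc (i F.↑ˡ n))))
                              (sumFin (λ j → f (F.suc (m F.↑ʳ j))))))

sum-combine : ∀ {m n} (f : ℤ^ (m * n)) →
  sumFin f ≡ sumFin (λ a → sumFin (λ b → f (F.combine {m} {n} a b)))
sum-combine {zero}      f = refl
sum-combine {suc m} {n} f = trans (sum-split {n} {m * n} f)
  (cong (sumFin (λ b → f (b F.↑ˡ (m * n))) +ᶻ_) (sum-combine {m} {n} (λ i → f (n F.↑ʳ i))))

neighbourSum : ∀ {N} → Graph N → ℤ^ N → ℤ^ N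
neighbourSum A f x = sumFin (λ y → + A x y *ᶻ f y)

laplacian-· : ∀ {N} (A : Graph N) (f : ℤ^ N) x → A x x ≡ 0 →
  (Laplacian A · f) x ≡ deg A x *ᶻ f x -ᶻ neighbourSum A f x
laplacian-· A f x loopless = begin
  sumFin (λ y → Laplacian A x y *ᶻ f y)
    ≡⟨ sum-cong entry ⟩
  sumFin (λ y → idMat x y *ᶻ (deg A x *ᶻ f x) -ᶻ + A x y *ᶻ f y)
    ≡⟨ sum-- (λ y → idMat x y *ᶻ (deg A x *ᶻ f x)) (λ y → + A x y *ᶻ f y) ⟩
  sumFin (λ y → idMat x y *ᶻ (deg A x *ᶻ f x)) -ᶻ neighbourSum A f x
    ≡⟨ cong (_-ᶻ neighbourSum A f x) (sum-δ x (λ _ → deg A x *ᶻ f x)) ⟩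
  deg A x *ᶻ f x -ᶻ neighbourSum A f x ∎
  where
  open ≡-Reasoning
  entry : ∀ y → Laplacian A x y *ᶻ f y ≡ idMat x y *ᶻ (deg A x *ᶻ f x) -ᶻ + A x y *ᶻ f y
  entry y with x F.≟ y
  ... | yes refl rewrite loopless = sym (trans (ZP.+-identityʳ _) (ZP.*-identityˡ _))
  ... | no _ = trans (sym (ZP.neg-distribˡ-* (+ A x y) (f y))) (sym (ZP.+-identityˡ _))

deg≡neighbourSum : ∀ {N} (A : Graph N) x → deg A x ≡ neighbourSum A (λ _ → + 1) x
deg≡neighbourSum A x = sum-cong (λ y → sym (ZP.*-identityʳ (+ A x y)))

□-combine : ∀ {m n} (A : Graph m) (B : Graph n) u v u' v' →
  (A □ B) (F.combine u v) (F.combine u' v') ≡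
  (if does (u F.≟ u') then B v v' else 0) N.+ (if does (v F.≟ v') then A u u' else 0)
□-combine {m} {n} A B u v u' v' =
  cong₂ G (FP.remQuot-combine {m} {n} u v) (FP.remQuot-combine {m} {n} u' v')
  where
  G : Fin m × Fin n → Fin m × Fin n → ℕ
  G (u , v) (u' , v') =
    (if does (u F.≟ u') then B v v' else 0) N.+ (if does (v F.≟ v') then A u u' else 0)

if≡δ* : ∀ b k → + (if b then k else 0) ≡ (if b then + 1 else + 0) *ᶻ + k
if≡δ* true  k = sym (ZP.*-identityˡ (+ k))
if≡δ* false k = refl

neighbourSum-□ : ∀ {m n} (A : Graph m) (B : Graph n) (f : ℤ^ (m * n)) u v →
  neighbourSum (A □ B) f (F.combine u v) ≡
  neighbourSum B (λ v' → f (F.combine u v')) v +ᶻ neighbourSum A (λ u' → f (F.combine u' v)) u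
neighbourSum-□ {m} {n} A B f u v = begin
  sumFin (λ y → + (A □ B) (F.combine u v) y *ᶻ f y)
    ≡⟨ sum-combine {m} {n} (λ y → + (A □ B) (F.combine u v) y *ᶻ f y) ⟩
  sumFin {m} (λ u' → sumFin {n} (λ v' → + (A □ B) (F.combine u v) (F.combine u' v') *ᶻ f (F.combine u' v')))
    ≡⟨ sum-cong {m} (λ u' → trans (sum-cong {n} (entry u')) (sum-+ {n} (δᵤ u') (δᵥ u'))) ⟩
  sumFin {m} (λ u' → sumFin {n} (δᵤ u') +ᶻ sumFin {n} (δᵥ u'))
    ≡⟨ sum-+ {m} (λ u' → sumFin {n} (δᵤ u')) (λ u' → sumFin {n} (δᵥ u')) ⟩
  sumFin {m} (λ u' → sumFin {n} (δᵤ u')) +ᶻ sumFin {m} (λ u' → sumFin {n} (δᵥ u'))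
    ≡⟨ cong₂ _+ᶻ_ along-B along-A ⟩
  neighbourSum B (λ v' → f (F.combine u v')) v +ᶻ neighbourSum A (λ u' → f (F.combine u' v)) u ∎
  where
  open ≡-Reasoning
  gB gA : Fin m → Fin n → ℤ
  gB u' v' = + B v v' *ᶻ f (F.combine u' v')
  gA u' v' = + A u u' *ᶻ f (F.combine u' v')
  δᵤ δᵥ : Fin m → Fin n → ℤ
  δᵤ u' v' = idMat u u' *ᶻ gB u' v'
  δᵥ u' v' = idMat v v' *ᶻ gA u' v'
  entry : ∀ u' v' → + (A □ B) (F.combine u v) (F.combine u' v') *ᶻ f (F.combine u' v')
                    ≡ δᵤ u' v' +ᶻ δᵥ u' v'
  entry u' v' = begin
    + (A □ B) (F.combine u v) (F.combine u' v') *ᶻ x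
      ≡⟨ cong (λ k → + k *ᶻ x) (□-combine A B u v u' v') ⟩
    + (bB N.+ bA) *ᶻ x
      ≡⟨ cong (_*ᶻ x) (trans (ZP.pos-+ bB bA)
                            (cong₂ _+ᶻ_ (if≡δ* (does (u F.≟ u')) (B v v'))
                                        (if≡δ* (does (v F.≟ v')) (A u u')))) ⟩
    (idMat u u' *ᶻ + B v v' +ᶻ idMat v v' *ᶻ + A u u') *ᶻ x
      ≡⟨ ZP.*-distribʳ-+ x (idMat u u' *ᶻ + B v v') (idMat v v' *ᶻ + A u u') ⟩
    idMat u u' *ᶻ + B v v' *ᶻ x +ᶻ idMat v v' *ᶻ + A u u' *ᶻ x
      ≡⟨ cong₂ _+ᶻ_ (ZP.*-assoc (idMat u u') (+ B v v') x) (ZP.*-assoc (idMat v v') (+ A u u') x) ⟩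
    δᵤ u' v' +ᶻ δᵥ u' v' ∎
    where
    x = f (F.combine u' v')
    bB = if does (u F.≟ u') then B v v' else 0
    bA = if does (v F.≟ v') then A u u' else 0
  along-B : sumFin {m} (λ u' → sumFin {n} (δᵤ u')) ≡ neighbourSum B (λ v' → f (F.combine u v')) v
  along-B = trans (sum-cong (λ u' → sum-*ˡ (idMat u u') (gB u'))) (sum-δ u (λ u' → sumFin (gB u')))
  along-A : sumFin {m} (λ u' → sumFin {n} (δᵥ u')) ≡ neighbourSum A (λ u' → f (F.combine u' v)) u
  along-A = trans (sum-swap δᵥ)
    (trans (sum-cong (λ v' → sum-*ˡ (idMat v v') (λ u' → gA u' v')))
           (sum-δ v (λ v' → sumFin (λ u' → gA u' v'))))

if-≟-refl : ∀ {m} (u : Fin m) (X : ℕ) → (if does (u F.≟ u) then X else 0) ≡ X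
if-≟-refl u X with u F.≟ u
... | yes _ = refl
... | no u≢u = ⊥-elim (u≢u refl)

□-loopless : ∀ {m n} (A : Graph m) (B : Graph n) u v → A u u ≡ 0 → B v v ≡ 0 →
  (A □ B) (F.combine u v) (F.combine u v) ≡ 0
□-loopless A B u v Auu≡0 Bvv≡0 = trans (□-combine A B u v u v)
  (cong₂ N._+_ (trans (if-≟-refl u (B v v)) Bvv≡0) (trans (if-≟-refl v (A u u)) Auu≡0))

mod-shift : ∀ m .{{_ : NonZero m}} a c → (toℕ (a ND.mod m) N.+ c) ND.mod m ≡ (a N.+ c) ND.mod m
mod-shift m a c = FP.fromℕ<-cong _ _
  (trans (cong (λ r → (r N.+ c) % m) (FP.toℕ-fromℕ< (ND.m%n<n a m))) (%-+ m a c))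
  (ND.m%n<n (toℕ (a ND.mod m) N.+ c) m) (ND.m%n<n (a N.+ c) m)

mod-cong : ∀ m .{{_ : NonZero m}} a a' → a % m ≡ a' % m → a ND.mod m ≡ a' ND.mod m
mod-cong m a a' e = FP.fromℕ<-cong _ _ e (ND.m%n<n a m) (ND.m%n<n a' m)

toℕ-mod : ∀ m .{{_ : NonZero m}} (u : Fin m) → toℕ u ND.mod m ≡ u
toℕ-mod m u = FP.toℕ-injective (trans (FP.toℕ-fromℕ< (ND.m%n<n (toℕ u) m)) (ND.m<n⇒m%n≡m (FP.toℕ<n u)))

argmax : ∀ {N} (f : ℤ^ (suc N)) → Σ (Fin (suc N)) λ x → ∀ y → f y Z.≤ f x
argmax {zero}  f = F.zero , λ { F.zero → ZP.≤-refl }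
argmax {suc N} f with argmax (f ∘ F.suc)
... | x , max with ZP.≤-total (f F.zero) (f (F.suc x))
... | inj₁ f₀≤ = F.suc x , λ { F.zero → f₀≤ ; (F.suc y) → max y }
... | inj₂ ≤f₀ = F.zero , λ { F.zero → ZP.≤-refl ; (F.suc y) → ZP.≤-trans (max y) ≤f₀ }

nonneg-sum≡0 : ∀ {p q} → + 0 Z.≤ p → + 0 Z.≤ q → p +ᶻ q ≡ + 0 → p ≡ + 0 × q ≡ + 0
nonneg-sum≡0 {+ a} {+ b} (+≤+ _) (+≤+ _) a+b≡0 =
  cong +_ (NP.m+n≡0⇒m≡0 a (ZP.+-injective a+b≡0)) , cong +_ (NP.m+n≡0⇒n≡0 a (ZP.+-injective a+b≡0))

four-max : ∀ M w x y z → w Z.≤ M → x Z.≤ M → y Z.≤ M → z Z.≤ M →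
  + 4 *ᶻ M -ᶻ ((w +ᶻ x) +ᶻ (y +ᶻ z)) ≡ + 0 → (w ≡ M × x ≡ M) × (y ≡ M × z ≡ M)
four-max M w x y z w≤M x≤M y≤M z≤M balance =
  (attains w (proj₁ wx) , attains x (proj₂ wx)) , (attains y (proj₁ yz) , attains z (proj₂ yz))
  where
  -- The defects M - v are nonnegative and sum to zero.
  defects : ∀ M w x y z → ((M -ᶻ w) +ᶻ (M -ᶻ x)) +ᶻ ((M -ᶻ y) +ᶻ (M -ᶻ z))
                           ≡ + 4 *ᶻ M -ᶻ ((w +ᶻ x) +ᶻ (y +ᶻ z))
  defects = solve-∀
  dw≥0 : + 0 Z.≤ M -ᶻ w
  dw≥0 = ZP.i≤j⇒0≤j-i w≤M
  dx≥0 : + 0 Z.≤ M -ᶻ x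
  dx≥0 = ZP.i≤j⇒0≤j-i x≤M
  dy≥0 : + 0 Z.≤ M -ᶻ y
  dy≥0 = ZP.i≤j⇒0≤j-i y≤M
  dz≥0 : + 0 Z.≤ M -ᶻ z
  dz≥0 = ZP.i≤j⇒0≤j-i z≤M
  halves : (M -ᶻ w) +ᶻ (M -ᶻ x) ≡ + 0 × (M -ᶻ y) +ᶻ (M -ᶻ z) ≡ + 0
  halves = nonneg-sum≡0 (ZP.+-mono-≤ dw≥0 dx≥0) (ZP.+-mono-≤ dy≥0 dz≥0)
             (trans (defects M w x y z) balance)
  wx : M -ᶻ w ≡ + 0 × M -ᶻ x ≡ + 0
  wx = nonneg-sum≡0 dw≥0 dx≥0 (proj₁ halves)
  yz : M -ᶻ y ≡ + 0 × M -ᶻ z ≡ + 0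
  yz = nonneg-sum≡0 dy≥0 dz≥0 (proj₂ halves)
  attains : ∀ v → M -ᶻ v ≡ + 0 → v ≡ M
  attains v d≡0 = sym (ZP.i-j≡0⇒i≡j M v d≡0)

-- The torus C_m × C_n (m = 3 + j, n = 3 + k).  Vertex functions are studied
-- through their doubly periodic lifts to ℕ × ℕ, on which the Laplacian is the
-- five-point stencil Δ.

module Torus (j k : ℕ) where
  module Cₘ = CycleGraph j
  module Cₙ = CycleGraph k
  open Cₙ public using (n)
  open Cₘ public using () renaming (n to m)

  G : Graph (m * n)
  G = Cycle m □ Cycle n

  L : Mat (m * n)
  L = Laplacian G

  Grid : Set
  Grid = ℕ → ℕ → ℤ

  lift : ℤ^ (m * n) → Grid
  lift f a b = f (F.combine (a ND.mod m) (b ND.mod n))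

  -- The five-point stencil; b + (n - 1) and a + (m - 1) stand for b - 1 and a - 1.
  Δ : Grid → Grid
  Δ H a b = + 4 *ᶻ H a b
          -ᶻ ((H a (b N.+ 1) +ᶻ H a (b N.+ (n N.∸ 1))) +ᶻ (H (a N.+ 1) b +ᶻ H (a N.+ (m N.∸ 1)) b))

  Δ-cong : ∀ {H H'} → (∀ a b → H a b ≡ H' a b) → ∀ a b → Δ H a b ≡ Δ H' a b
  Δ-cong H≡H' a b = cong₂ (λ p q → + 4 *ᶻ p -ᶻ q) (H≡H' a b)
    (cong₂ _+ᶻ_ (cong₂ _+ᶻ_ (H≡H' a (b N.+ 1)) (H≡H' a (b N.+ (n N.∸ 1))))
                (cong₂ _+ᶻ_ (H≡H' (a N.+ 1) b) (H≡H' (a N.+ (m N.∸ 1)) b)))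

  Δ-translate-difference : ∀ H s a b →
    Δ (λ a b → H a (b N.+ s) -ᶻ H a b) a b ≡ Δ H a (b N.+ s) -ᶻ Δ H a b
  Δ-translate-difference H s a b = begin
    + 4 *ᶻ (H a (b N.+ s) -ᶻ H a b)
      -ᶻ (((H a (b N.+ 1 N.+ s) -ᶻ H a (b N.+ 1)) +ᶻ (H a (b N.+ (n N.∸ 1) N.+ s) -ᶻ H a (b N.+ (n N.∸ 1))))
         +ᶻ ((H (a N.+ 1) (b N.+ s) -ᶻ H (a N.+ 1) b) +ᶻ (H (a N.+ (m N.∸ 1)) (b N.+ s) -ᶻ H (a N.+ (m N.∸ 1)) b)))
      ≡⟨ cong₂ (λ p q → + 4 *ᶻ (H a (b N.+ s) -ᶻ H a b)
                        -ᶻ (((p -ᶻ H a (b N.+ 1)) +ᶻ (q -ᶻ H a (b N.+ (n N.∸ 1))))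
                           +ᶻ ((H (a N.+ 1) (b N.+ s) -ᶻ H (a N.+ 1) b)
                              +ᶻ (H (a N.+ (m N.∸ 1)) (b N.+ s) -ᶻ H (a N.+ (m N.∸ 1)) b))))
               (cong (H a) (swap-summands b 1 s)) (cong (H a) (swap-summands b (n N.∸ 1) s)) ⟩
    _ ≡⟨ difference-of-stencils (H a b) (H a (b N.+ 1)) (H a (b N.+ (n N.∸ 1))) (H (a N.+ 1) b) (H (a N.+ (m N.∸ 1)) b)
           (H a (b N.+ s)) (H a (b N.+ s N.+ 1)) (H a (b N.+ s N.+ (n N.∸ 1)))
           (H (a N.+ 1) (b N.+ s)) (H (a N.+ (m N.∸ 1)) (b N.+ s)) ⟩
    Δ H a (b N.+ s) -ᶻ Δ H a b ∎
    where
    open ≡-Reasoning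
    swap-summands : ∀ b c s → b N.+ c N.+ s ≡ b N.+ s N.+ c
    swap-summands = ℕ-Solver.solve-∀
    difference-of-stencils : ∀ A B C D E A' B' C' D' E' →
      + 4 *ᶻ (A' -ᶻ A) -ᶻ (((B' -ᶻ B) +ᶻ (C' -ᶻ C)) +ᶻ ((D' -ᶻ D) +ᶻ (E' -ᶻ E)))
      ≡ (+ 4 *ᶻ A' -ᶻ ((B' +ᶻ C') +ᶻ (D' +ᶻ E'))) -ᶻ (+ 4 *ᶻ A -ᶻ ((B +ᶻ C) +ᶻ (D +ᶻ E)))
    difference-of-stencils = solve-∀

  torus-neighbours : ∀ (f : ℤ^ (m * n)) u v → neighbourSum G f (F.combine u v) ≡
     (f (F.combine u (Cₙ.next v)) +ᶻ f (F.combine u (Cₙ.prev v)))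
     +ᶻ (f (F.combine (Cₘ.next u) v) +ᶻ f (F.combine (Cₘ.prev u) v))
  torus-neighbours f u v = trans (neighbourSum-□ (Cycle m) (Cycle n) f u v)
    (cong₂ _+ᶻ_ (Cₙ.sum-over-neighbours v (λ v' → f (F.combine u v')))
                (Cₘ.sum-over-neighbours u (λ u' → f (F.combine u' v))))

  laplacian-lift : ∀ f a b → lift (L · f) a b ≡ Δ (lift f) a b
  laplacian-lift f a b = trans (laplacian-· G f x loopless)
    (cong₂ (λ d s → d *ᶻ f x -ᶻ s)
      (trans (deg≡neighbourSum G x) (torus-neighbours (λ _ → + 1) u v))
      (trans (torus-neighbours f u v)
        (cong₂ _+ᶻ_ (cong₂ _+ᶻ_ (cong (λ r → f (F.combine u r)) (mod-shift n b 1))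
                                (cong (λ r → f (F.combine u r)) (mod-shift n b (n N.∸ 1))))
                    (cong₂ _+ᶻ_ (cong (λ r → f (F.combine r v)) (mod-shift m a 1))
                                (cong (λ r → f (F.combine r v)) (mod-shift m a (m N.∸ 1)))))))
    where
    u = a ND.mod m
    v = b ND.mod n
    x = F.combine u v
    loopless : G x x ≡ 0
    loopless = □-loopless (Cycle m) (Cycle n) u v (Cₘ.cycle-loopless u) (Cₙ.cycle-loopless v)

  -- Grid functions coming from vertex functions are exactly the doubly periodic ones.
  Periodic : Grid → Set
  Periodic H = ∀ a b → H a b ≡ H (a % m) (b % n)

  periodic-cong : ∀ {H} → Periodic H → ∀ a a' b b' → a % m ≡ a' % m → b % n ≡ b' % n →
    H a b ≡ H a' b'
  periodic-cong {H} per a a' b b' a≡a' b≡b' =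
    trans (per a b) (trans (cong₂ H a≡a' b≡b') (sym (per a' b')))

  lift-cong : ∀ f a a' b b' → a % m ≡ a' % m → b % n ≡ b' % n → lift f a b ≡ lift f a' b'
  lift-cong f a a' b b' a≡a' b≡b' =
    cong₂ (λ u v → f (F.combine u v)) (mod-cong m a a' a≡a') (mod-cong n b b' b≡b')

  lift-periodic : ∀ f → Periodic (lift f)
  lift-periodic f a b = lift-cong f a (a % m) b (b % n) (sym (ND.m%n%n≡m%n a m)) (sym (ND.m%n%n≡m%n b n))

  coords : Fin (m * n) → ℕ × ℕ
  coords x = toℕ (proj₁ (F.remQuot {m} n x)) , toℕ (proj₂ (F.remQuot {m} n x))

  unlift : Grid → ℤ^ (m * n)
  unlift H x = H (proj₁ (coords x)) (proj₂ (coords x))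

  lift-unlift : ∀ {H} → Periodic H → ∀ a b → lift (unlift H) a b ≡ H a b
  lift-unlift {H} per a b = begin
    unlift H (F.combine (a ND.mod m) (b ND.mod n))
      ≡⟨ cong (λ p → H (toℕ (proj₁ p)) (toℕ (proj₂ p))) (FP.remQuot-combine (a ND.mod m) (b ND.mod n)) ⟩
    H (toℕ (a ND.mod m)) (toℕ (b ND.mod n))
      ≡⟨ cong₂ H (FP.toℕ-fromℕ< (ND.m%n<n a m)) (FP.toℕ-fromℕ< (ND.m%n<n b n)) ⟩
    H (a % m) (b % n) ≡⟨ sym (per a b) ⟩
    H a b ∎
    where open ≡-Reasoning

  lift-coords : ∀ (f : ℤ^ (m * n)) x → lift f (proj₁ (coords x)) (proj₂ (coords x)) ≡ f x
  lift-coords f x = trans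
    (cong₂ (λ u v → f (F.combine u v)) (toℕ-mod m (proj₁ (F.remQuot {m} n x))) (toℕ-mod n (proj₂ (F.remQuot {m} n x))))
    (cong f (FP.combine-remQuot {m} n x))

  lift-injective : ∀ (f g : ℤ^ (m * n)) → (∀ a b → lift f a b ≡ lift g a b) → ∀ x → f x ≡ g x
  lift-injective f g f≡g x = trans (sym (lift-coords f x))
    (trans (f≡g (proj₁ (coords x)) (proj₂ (coords x))) (lift-coords g x))

  -- Maximum principle: a periodic harmonic grid function equals its maximum
  -- everywhere, since the maximum propagates to all four neighbours.
  module MaximumPrinciple (H : Grid) (per : Periodic H) (harmonic : ∀ a b → Δ H a b ≡ + 0) where
    x₀ : Fin (m * n)
    x₀ = proj₁ (argmax (unlift H))
    M : ℤ
    M = unlift H x₀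

    bounded : ∀ a b → H a b Z.≤ M
    bounded a b = subst (Z._≤ M) (lift-unlift per a b)
                        (proj₂ (argmax (unlift H)) (F.combine (a ND.mod m) (b ND.mod n)))

    spreads : ∀ a b → H a b ≡ M →
      (H a (b N.+ 1) ≡ M × H a (b N.+ (n N.∸ 1)) ≡ M) × (H (a N.+ 1) b ≡ M × H (a N.+ (m N.∸ 1)) b ≡ M)
    spreads a b Hab≡M = four-max M w x y z
      (bounded a (b N.+ 1)) (bounded a (b N.+ (n N.∸ 1))) (bounded (a N.+ 1) b) (bounded (a N.+ (m N.∸ 1)) b)
      (trans (cong (λ c → + 4 *ᶻ c -ᶻ ((w +ᶻ x) +ᶻ (y +ᶻ z))) (sym Hab≡M)) (harmonic a b))
      where
      w = H a (b N.+ 1)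
      x = H a (b N.+ (n N.∸ 1))
      y = H (a N.+ 1) b
      z = H (a N.+ (m N.∸ 1)) b

    spreads-right : ∀ a b i → H a b ≡ M → H (a N.+ i) b ≡ M
    spreads-right a b zero    Hab≡M = trans (cong (λ c → H c b) (NP.+-identityʳ a)) Hab≡M
    spreads-right a b (suc i) Hab≡M = trans (cong (λ c → H c b) (trans (NP.+-suc a i) (NP.+-comm 1 (a N.+ i))))
      (proj₁ (proj₂ (spreads (a N.+ i) b (spreads-right a b i Hab≡M))))

    spreads-up : ∀ a b i → H a b ≡ M → H a (b N.+ i) ≡ M
    spreads-up a b zero    Hab≡M = trans (cong (H a) (NP.+-identityʳ b)) Hab≡M
    spreads-up a b (suc i) Hab≡M = trans (cong (H a) (trans (NP.+-suc b i) (NP.+-comm 1 (b N.+ i))))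
      (proj₁ (proj₁ (spreads a (b N.+ i) (spreads-up a b i Hab≡M))))

    -- Every point is congruent to one reachable from the maximum by steps +1:
    -- x₀ + (c + (p - 1) x₀) = c + p x₀ ≡ c (mod p).
    reach : ∀ c x r → x N.+ (c N.+ suc (suc r) N.* x) ≡ c N.+ x N.* suc (suc (suc r))
    reach = ℕ-Solver.solve-∀

    everywhere : ∀ a b → H a b ≡ M
    everywhere a b = trans
      (periodic-cong per a (a₀ N.+ (a N.+ (m N.∸ 1) N.* a₀)) b (b₀ N.+ (b N.+ (n N.∸ 1) N.* b₀))
        (sym (trans (cong (_% m) (reach a a₀ j)) (ND.[m+kn]%n≡m%n a a₀ m)))
        (sym (trans (cong (_% n) (reach b b₀ k)) (ND.[m+kn]%n≡m%n b b₀ n))))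
      (spreads-right a₀ _ _ (spreads-up a₀ b₀ _ refl))
      where
      a₀ b₀ : ℕ
      a₀ = proj₁ (coords x₀)
      b₀ = proj₂ (coords x₀)

  harmonic⇒constant : ∀ H → Periodic H → (∀ a b → Δ H a b ≡ + 0) → ∀ a b a' b' → H a b ≡ H a' b'
  harmonic⇒constant H per harmonic a b a' b' = trans (everywhere a b) (sym (everywhere a' b'))
    where open MaximumPrinciple H per harmonic

  constantKernel : ConstantKernel L
  constantKernel f Lf≡0 x y = begin
    f x                                            ≡⟨ sym (lift-coords f x) ⟩
    lift f (proj₁ (coords x)) (proj₂ (coords x))   ≡⟨ harmonic⇒constant (lift f) (lift-periodic f) harmonic
                                                        (proj₁ (coords x)) (proj₂ (coords x))
                                                        (proj₁ (coords y)) (proj₂ (coords y)) ⟩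
    lift f (proj₁ (coords y)) (proj₂ (coords y))   ≡⟨ lift-coords f y ⟩
    f y ∎
    where
    open ≡-Reasoning
    harmonic : ∀ a b → Δ (lift f) a b ≡ + 0
    harmonic a b = trans (sym (laplacian-lift f a b)) (Lf≡0 (F.combine (a ND.mod m) (b ND.mod n)))

iterate-translation : ∀ (g : ℕ → ℤ) s c → (∀ b → g (b N.+ s) ≡ g b +ᶻ c) →
  ∀ b i → g (b N.+ i N.* s) ≡ g b +ᶻ + i *ᶻ c
iterate-translation g s c step b zero    = trans (cong g (NP.+-identityʳ b))
  (sym (trans (cong (g b +ᶻ_) (ZP.*-zeroˡ c)) (ZP.+-identityʳ (g b))))
iterate-translation g s c step b (suc i) = begin
  g (b N.+ (s N.+ i N.* s))      ≡⟨ cong g (regroup b i s) ⟩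
  g (b N.+ i N.* s N.+ s)        ≡⟨ step (b N.+ i N.* s) ⟩
  g (b N.+ i N.* s) +ᶻ c         ≡⟨ cong (_+ᶻ c) (iterate-translation g s c step b i) ⟩
  g b +ᶻ + i *ᶻ c +ᶻ c           ≡⟨ one-more (g b) (+ i) c ⟩
  g b +ᶻ + suc i *ᶻ c ∎
  where
  open ≡-Reasoning
  regroup : ∀ b i s → b N.+ (s N.+ i N.* s) ≡ b N.+ i N.* s N.+ s
  regroup = ℕ-Solver.solve-∀
  one-more : ∀ x i c → x +ᶻ i *ᶻ c +ᶻ c ≡ x +ᶻ (+ 1 +ᶻ i) *ᶻ c
  one-more = solve-∀

module TorusCovering (j k₁ k₂ : ℕ) (n₁∣n₂ : suc (suc (suc k₁)) ∣ suc (suc (suc k₂))) where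
  module T₁ = Torus j k₁
  module T₂ = Torus j k₂
  open T₁ using (m)
  n₁ n₂ : ℕ
  n₁ = T₁.n
  n₂ = T₂.n

  q : ℕ
  q = NDv.quotient n₁∣n₂

  n₂≡qn₁ : n₂ ≡ q N.* n₁
  n₂≡qn₁ = NDv._∣_.equality n₁∣n₂

  q≢0 : q ≢ 0
  q≢0 q≡0 with trans n₂≡qn₁ (cong (N._* n₁) q≡0)
  ... | ()

  π : Fin (m * n₂) → Fin (m * n₁)
  π x = F.combine (proj₁ (F.remQuot {m} n₂ x)) (toℕ (proj₂ (F.remQuot {m} n₂ x)) ND.mod n₁)

  section : Fin (m * n₁) → Fin (m * n₂)
  section x = F.combine (proj₁ (F.remQuot {m} n₁ x)) (toℕ (proj₂ (F.remQuot {m} n₁ x)) ND.mod n₂)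

  π-combine : ∀ u v → π (F.combine u v) ≡ F.combine u (toℕ v ND.mod n₁)
  π-combine u v = cong (λ p → F.combine (proj₁ p) (toℕ (proj₂ p) ND.mod n₁)) (FP.remQuot-combine {m} {n₂} u v)

  π∘section : ∀ x → π (section x) ≡ x
  π∘section x = begin
    π (F.combine u (toℕ v ND.mod n₂))      ≡⟨ π-combine u (toℕ v ND.mod n₂) ⟩
    F.combine u (toℕ (toℕ v ND.mod n₂) ND.mod n₁)
      ≡⟨ cong (F.combine u) (trans (mod-cong n₁ (toℕ (toℕ v ND.mod n₂)) (toℕ v) (cong (_% n₁) v-small))
                                   (toℕ-mod n₁ v)) ⟩
    F.combine u v                          ≡⟨ FP.combine-remQuot {m} n₁ x ⟩
    x ∎
    where
    open ≡-Reasoning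
    u = proj₁ (F.remQuot {m} n₁ x)
    v = proj₂ (F.remQuot {m} n₁ x)
    v-small : toℕ (toℕ v ND.mod n₂) ≡ toℕ v
    v-small = trans (FP.toℕ-fromℕ< (ND.m%n<n (toℕ v) n₂))
                    (ND.m<n⇒m%n≡m (NP.<-≤-trans (FP.toℕ<n v) (NDv.∣⇒≤ n₁∣n₂)))

  lift-pullback : ∀ (f : ℤ^ (m * n₁)) a b → T₂.lift (f ∘ π) a b ≡ T₁.lift f a b
  lift-pullback f a b = trans (cong f (π-combine (a ND.mod m) (b ND.mod n₂)))
    (cong (λ r → f (F.combine (a ND.mod m) r)) (mod-cong n₁ (toℕ (b ND.mod n₂)) b
        (trans (cong (_% n₁) (FP.toℕ-fromℕ< (ND.m%n<n b n₂))) (ND.m∣n⇒o%n%m≡o%m n₁ n₂ b n₁∣n₂))))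

  -- On n₁-periodic grid functions the stencils of both tori agree, because
  -- n₂ - 1 ≡ n₁ - 1 (mod n₁).
  Δ₂≡Δ₁ : ∀ (f : ℤ^ (m * n₁)) a b → T₂.Δ (T₁.lift f) a b ≡ T₁.Δ (T₁.lift f) a b
  Δ₂≡Δ₁ f a b = cong (λ r → + 4 *ᶻ T₁.lift f a b -ᶻ ((T₁.lift f a (b N.+ 1) +ᶻ r)
                              +ᶻ (T₁.lift f (a N.+ 1) b +ᶻ T₁.lift f (a N.+ (m N.∸ 1)) b)))
    (T₁.lift-cong f a a (b N.+ (n₂ N.∸ 1)) (b N.+ (n₁ N.∸ 1)) refl (begin
      (b N.+ (n₂ N.∸ 1)) % n₁                          ≡⟨ cong (λ r → (b N.+ r) % n₁) (n₂-1≡ q n₂≡qn₁) ⟩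
      (b N.+ ((n₁ N.∸ 1) N.+ pred q N.* n₁)) % n₁      ≡⟨ cong (_% n₁) (sym (NP.+-assoc b (n₁ N.∸ 1) _)) ⟩
      (b N.+ (n₁ N.∸ 1) N.+ pred q N.* n₁) % n₁        ≡⟨ ND.[m+kn]%n≡m%n (b N.+ (n₁ N.∸ 1)) (pred q) n₁ ⟩
      (b N.+ (n₁ N.∸ 1)) % n₁ ∎))
    where
    open ≡-Reasoning
    n₂-1≡ : ∀ r → n₂ ≡ r N.* n₁ → n₂ N.∸ 1 ≡ (n₁ N.∸ 1) N.+ pred r N.* n₁
    n₂-1≡ zero    ()
    n₂-1≡ (suc r) n₂≡rn₁ = cong (N._∸ 1) n₂≡rn₁

  pullback-commutes : ∀ (f : ℤ^ (m * n₁)) x → (T₂.L · (f ∘ π)) x ≡ (T₁.L · f) (π x)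
  pullback-commutes f = T₂.lift-injective (T₂.L · (f ∘ π)) (λ x → (T₁.L · f) (π x)) λ a b → begin
    T₂.lift (T₂.L · (f ∘ π)) a b       ≡⟨ T₂.laplacian-lift (f ∘ π) a b ⟩
    T₂.Δ (T₂.lift (f ∘ π)) a b         ≡⟨ T₂.Δ-cong (lift-pullback f) a b ⟩
    T₂.Δ (T₁.lift f) a b               ≡⟨ Δ₂≡Δ₁ f a b ⟩
    T₁.Δ (T₁.lift f) a b               ≡⟨ sym (T₁.laplacian-lift f a b) ⟩
    T₁.lift (T₁.L · f) a b             ≡⟨ sym (lift-pullback (T₁.L · f) a b) ⟩
    T₂.lift ((T₁.L · f) ∘ π) a b ∎
    where open ≡-Reasoning

  -- Descent: if L₂ z = y ∘ π then z is n₁-periodic in the second coordinate,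
  -- hence a pull-back.  The vertical n₁-difference of z is harmonic, so it is a
  -- constant c; translating q times by n₁ is the identity, so q c = 0.
  module Descent (z : ℤ^ (m * n₂)) (y : ℤ^ (m * n₁)) (Lz≡yπ : ∀ x → (T₂.L · z) x ≡ y (π x)) where
    Z : T₂.Grid
    Z = T₂.lift z

    ΔZ≡Y : ∀ a b → T₂.Δ Z a b ≡ T₁.lift y a b
    ΔZ≡Y a b = trans (sym (T₂.laplacian-lift z a b))
                     (trans (Lz≡yπ (F.combine (a ND.mod m) (b ND.mod n₂))) (lift-pullback y a b))

    D : T₂.Grid
    D a b = Z a (b N.+ n₁) -ᶻ Z a b

    D-periodic : T₂.Periodic D
    D-periodic a b = cong₂ _-ᶻ_
      (T₂.lift-cong z a (a % m) (b N.+ n₁) (b % n₂ N.+ n₁) (sym (ND.m%n%n≡m%n a m)) (sym (%-+ n₂ b n₁)))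
      (T₂.lift-periodic z a b)

    D-harmonic : ∀ a b → T₂.Δ D a b ≡ + 0
    D-harmonic a b = begin
      T₂.Δ D a b                                              ≡⟨ T₂.Δ-translate-difference Z n₁ a b ⟩
      T₂.Δ Z a (b N.+ n₁) -ᶻ T₂.Δ Z a b                       ≡⟨ cong₂ _-ᶻ_ (ΔZ≡Y a (b N.+ n₁)) (ΔZ≡Y a b) ⟩
      T₁.lift y a (b N.+ n₁) -ᶻ T₁.lift y a b                 ≡⟨ cong (_-ᶻ T₁.lift y a b)
                                                                   (T₁.lift-cong y a a (b N.+ n₁) b refl (ND.[m+n]%n≡m%n b n₁)) ⟩
      T₁.lift y a b -ᶻ T₁.lift y a b                          ≡⟨ ZP.+-inverseʳ (T₁.lift y a b) ⟩
      + 0 ∎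
      where open ≡-Reasoning

    c : ℤ
    c = D 0 0

    D≡c : ∀ a b → D a b ≡ c
    D≡c a b = T₂.harmonic⇒constant D D-periodic D-harmonic a b 0 0

    Z-progression : ∀ a b i → Z a (b N.+ i N.* n₁) ≡ Z a b +ᶻ + i *ᶻ c
    Z-progression a = iterate-translation (Z a) n₁ c λ b → solve-for (D≡c a b)
      where
      solve-for : ∀ {x y c} → x -ᶻ y ≡ c → x ≡ y +ᶻ c
      solve-for {x} {y} refl = sym (rearrange x y)
        where
        rearrange : ∀ x y → y +ᶻ (x -ᶻ y) ≡ x
        rearrange = solve-∀

    c≡0 : c ≡ + 0
    c≡0 = cancel-nonzero q c q≢0 (begin
      + q *ᶻ c                               ≡⟨ isolate (Z 0 0) (+ q *ᶻ c) ⟩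
      (Z 0 0 +ᶻ + q *ᶻ c) -ᶻ Z 0 0           ≡⟨ cong (_-ᶻ Z 0 0) (sym (Z-progression 0 0 q)) ⟩
      Z 0 (q N.* n₁) -ᶻ Z 0 0                ≡⟨ cong (_-ᶻ Z 0 0) full-turn ⟩
      Z 0 0 -ᶻ Z 0 0                         ≡⟨ ZP.+-inverseʳ (Z 0 0) ⟩
      + 0 ∎)
      where
      open ≡-Reasoning
      isolate : ∀ a x → x ≡ (a +ᶻ x) -ᶻ a
      isolate = solve-∀
      full-turn : Z 0 (q N.* n₁) ≡ Z 0 0
      full-turn = T₂.lift-cong z 0 0 (q N.* n₁) 0 refl
        (trans (cong (_% n₂) (sym n₂≡qn₁)) (ND.n%n≡0 n₂))

    Z-periodic₁ : T₁.Periodic Z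
    Z-periodic₁ a b = begin
      Z a b                                    ≡⟨ cong (Z a) (ND.m≡m%n+[m/n]*n b n₁) ⟩
      Z a (b % n₁ N.+ (b ND./ n₁) N.* n₁)      ≡⟨ Z-progression a (b % n₁) (b ND./ n₁) ⟩
      Z a (b % n₁) +ᶻ + (b ND./ n₁) *ᶻ c       ≡⟨ cong (λ c → Z a (b % n₁) +ᶻ + (b ND./ n₁) *ᶻ c) c≡0 ⟩
      Z a (b % n₁) +ᶻ + (b ND./ n₁) *ᶻ + 0     ≡⟨ cong (Z a (b % n₁) +ᶻ_) (ZP.*-zeroʳ (+ (b ND./ n₁))) ⟩
      Z a (b % n₁) +ᶻ + 0                      ≡⟨ ZP.+-identityʳ (Z a (b % n₁)) ⟩
      Z a (b % n₁)                             ≡⟨ T₂.lift-cong z a (a % m) (b % n₁) (b % n₁) (sym (ND.m%n%n≡m%n a m)) refl ⟩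
      Z (a % m) (b % n₁) ∎
      where open ≡-Reasoning

    w : ℤ^ (m * n₁)
    w = T₁.unlift Z

    z≡wπ : ∀ x → z x ≡ w (π x)
    z≡wπ = T₂.lift-injective z (w ∘ π) λ a b →
      sym (trans (lift-pullback w a b) (T₁.lift-unlift Z-periodic₁ a b))

  covering : Covering T₁.L T₂.L
  covering = record
    { π = π
    ; section = section
    ; π∘section = π∘section
    ; pullback-commutes = pullback-commutes
    ; descent = λ z y Lz≡yπ → Descent.w z y Lz≡yπ , Descent.z≡wπ z y Lz≡yπ
    }

theorem5p2 : (n₁ n₂ : ℕ) → 3 ≤ n₁ → 3 ≤ n₂ → n₁ ∣ n₂ →
    (t₁ : Fin (pred (4 * n₁)) → ℕ) → (t₂ : Fin (pred (4 * n₂)) → ℕ) →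
    IsSNF (Laplacian (C4×C n₁)) t₁ → IsSNF (Laplacian (C4×C n₂)) t₂ →
    EmbedsInto t₁ t₂
theorem5p2 _ _ (s≤s (s≤s (s≤s {n = k₁} _))) (s≤s (s≤s (s≤s {n = k₂} _))) n₁∣n₂ t₁ t₂ snf₁ snf₂ =
  CoveringEmbedding.embedding (TorusCovering.covering 1 k₁ k₂ n₁∣n₂) (Torus.constantKernel 1 k₁)
    snf₁ snf₂
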